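{- Let $p$ be an odd prime, $a$ an integer with $p\nmid a$, $b=b_0p^{b_1}$, $c=c_0p^{c_1}$ with $0\le b_1\le c_1$, $\gcd(b_0,p)=\gcd(c_0,p)=1$, and let $m=m_0p^{m_1}$ be a nonzero integer with $\gcd(m_0,p)=1$. Let $k>m_1$ be an integer and for $0\le\tau\le k-1$ set $$s_{k,\tau}=\sum_{t_0\in(\mathbb Z/p^{k-\tau}\mathbb Z)^*}e\!\left(\frac{ -m_0t_0p^{m_1+\tau}}{p^k}\right)G(at_0p^\tau;p^k)\,G(b_0t_0p^{b_1+\tau};p^k)\,G(c_0t_0p^{c_1+\tau};p^k).$$ Let $n_1=\min(m_1,b_1)$. Then $$\sum_{\tau=k-n_1}^{k-1}s_{k,\tau}=\sum_{\substack{\tau=k-n_1\\ k-\tau\text{ even}}}^{k-1}p^{3k+(k-\tau)/2}\left(1-\frac1p\right)=p^{3k}\left(p^{\lfloor n_1/2\rfloor}-1\right).$$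
   Context: $e(w)=e^{2\pi i w}$; $G(a;q)=\sum_{j=0}^{q-1}e\!\left(\frac{aj^2}{q}\right)$; $\lfloor x\rfloor$ is the greatest integer $\le x$. -}

module Defs where

open import Data.Nat as ℕ using (ℕ; _∸_; _^_; _≤ᵇ_; ⌊_/2⌋)
open import Data.Nat.Divisibility using (_∣?_)
open import Data.Integer as ℤ using (ℤ; +_; 0ℤ; 1ℤ; -_)
open import Data.Integer.GCD using (gcd)
open import Data.Product using (Σ; _×_; _,_)
open import Data.List using (List; []; _∷_; _++_; map; concatMap; upTo; foldr)
open import Data.Bool using (if_then_else_)
import Data.Bool
open import Relation.Nullary.Decidable using (⌊_⌋)
open import Relation.Binary.PropositionalEquality using (_≡_)

-- The cyclotomic ring Z[ζ], ζ = e(1/p^k), modelled exactly.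
-- An element is a formal Z-linear combination  Σ c · e(r / p^k)
-- (r ∈ Z), i.e. a Laurent polynomial Σ c x^r, written as a list of
-- (coefficient , exponent) pairs.  Two such combinations are equal
-- as complex numbers iff their difference lies in the ideal generated
-- by the cyclotomic polynomial Φ_{p^k}(x) = Σ_{i<p} x^{i p^{k-1}}
-- (the minimal polynomial of e(1/p^k)).

sumℤ : List ℤ → ℤ
sumℤ = foldr ℤ._+_ 0ℤ

Cyc : Set
Cyc = List (ℤ × ℤ)

-- e(r / p^k)   (the modulus p^k is fixed by the ambient relation)
eN : ℤ → Cyc
eN r = (1ℤ , r) ∷ []

const : ℤ → Cyc
const n = (n , 0ℤ) ∷ []

_⊗_ : Cyc → Cyc → Cyc
xs ⊗ ys = concatMap (λ { (c , r) → map (λ { (d , s) → (c ℤ.* d , r ℤ.+ s) }) ys }) xs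

Σ< : ℕ → (ℕ → Cyc) → Cyc
Σ< n f = concatMap f (upTo n)

coeff : Cyc → ℤ → ℤ
coeff xs r = sumℤ (map (λ { (c , s) → if ⌊ s ℤ.≟ r ⌋ then c else 0ℤ }) xs)

Φ : ℕ → ℕ → Cyc
Φ p k = Σ< p (λ i → eN (+ (i ℕ.* p ^ (k ∸ 1))))

_≈[_^_]_ : Cyc → ℕ → ℕ → Cyc → Set
x ≈[ p ^ k ] y = Σ Cyc λ q → ∀ r → coeff x r ≡ coeff y r ℤ.+ coeff (q ⊗ Φ p k) r

G : ℕ → ℕ → ℤ → Cyc
G p k x = Σ< (p ^ k) (λ j → eN (x ℤ.* + (j ℕ.* j)))

s : (p : ℕ) (a b₀ : ℤ) (b₁ : ℕ) (c₀ : ℤ) (c₁ : ℕ) (m₀ : ℤ) (m₁ k τ : ℕ) → Cyc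
s p a b₀ b₁ c₀ c₁ m₀ m₁ k τ =
  Σ< (p ^ (k ∸ τ)) λ t₀ →
    if ⌊ p ∣? t₀ ⌋ then [] else
      (eN (ℤ.- (m₀ ℤ.* + t₀ ℤ.* + (p ^ (m₁ ℕ.+ τ))))
       ⊗ (G p k (a ℤ.* + t₀ ℤ.* + (p ^ τ))
       ⊗ (G p k (b₀ ℤ.* + t₀ ℤ.* + (p ^ (b₁ ℕ.+ τ)))
       ⊗ G p k (c₀ ℤ.* + t₀ ℤ.* + (p ^ (c₁ ℕ.+ τ))))))

lhsSum : (p : ℕ) (a b₀ : ℤ) (b₁ : ℕ) (c₀ : ℤ) (c₁ : ℕ) (m₀ : ℤ) (m₁ k : ℕ) → Cyc
lhsSum p a b₀ b₁ c₀ c₁ m₀ m₁ k =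
  Σ< k λ τ → if (k ∸ m₁ ℕ.⊓ b₁) ≤ᵇ τ then s p a b₀ b₁ c₀ c₁ m₀ m₁ k τ else []

-- Σ_{τ = k-n₁, k-τ even}^{k-1} p^{3k + (k-τ)/2} (1 - 1/p)
--   = Σ ... p^{3k + (k-τ)/2 - 1} (p - 1)      (an integer, as 3k ≥ 1)
midSum : (p n₁ k : ℕ) → ℤ
midSum p n₁ k =
  sumℤ (map (λ τ → if ((k ∸ n₁) ≤ᵇ τ) Data.Bool.∧ ⌊ 2 ∣? (k ∸ τ) ⌋
                  then + (p ^ (3 ℕ.* k ℕ.+ ⌊ (k ∸ τ) /2⌋ ∸ 1)) ℤ.* (+ p ℤ.- 1ℤ)
                  else 0ℤ) (upTo k))

-- For k - n₁ ≤ τ < k the twist by m₀ and the Gauss sums in b₀, c₀ have arguments divisible by p^k, so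
-- s_{k,τ} = p^{2k} Σ_{t unit mod p^J} G(a t p^τ; p^k) with J = k - τ.  Exchanging the sums gives
-- p^{2k} Σ_{j mod p^k} c_{p^J}(a j²) with the Ramanujan sum c_{p^J}(w) = p^J [p^J ∣ w] - p^{J-1} [p^{J-1} ∣ w],
-- which comes from the orthogonality relation Σ_{t mod p^J} e(wt/p^J) = p^J [p^J ∣ w]; for p ∤ w the latter
-- vanishes because i ↦ w i permutes the residues mod p and Σ_{i<p} ζ^{c + i p^{k-1}} = ζ^c Φ_{p^k}(ζ) = 0.
-- As p ∤ a, p^e ∣ a j² iff p^⌈e/2⌉ ∣ j, hence Σ_j p^e [p^e ∣ a j²] = p^{k+⌊e/2⌋} and
-- s_{k,τ} = p^{3k} (p^{⌊J/2⌋} - p^{⌊(J-1)/2⌋}), which is p^{3k+J/2-1} (p - 1) for even J and 0 for odd J.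
-- Summed over τ this telescopes to p^{3k} (p^{⌊n₁/2⌋} - 1).

module Submission where

open import Defs
open import Data.Nat as ℕ using (ℕ; zero; suc; _<_; _≤_; _^_; _∸_; _≤ᵇ_; ⌊_/2⌋; ⌈_/2⌉; NonZero; z≤n; s≤s)
import Data.Nat.Properties as ℕ
open import Data.Nat.DivMod using (_%_; _/_; m≡m%n+[m/n]*n; m%n<n; m<n⇒m%n≡m)
open import Data.Nat.Divisibility
  using (_∣_; _∣?_; divides; divides-refl; ∣-refl; ∣-trans; 1∣_; n∣m*n; m∣m*n; ∣m⇒∣m*n; ∣n⇒∣m*n; ∣m+n∣m⇒∣n; ∣⇒≤;
         n∣m⇒m%n≡0; *-monoʳ-∣; *-monoˡ-∣; *-cancelˡ-∣; *-cancelʳ-∣)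
open import Data.Nat.Primality using (Prime; euclidsLemma; prime⇒nonZero)
import Data.Nat.Tactic.RingSolver as ℕ-Solver
open import Data.Integer as ℤ using (ℤ; +_; -[1+_]; 0ℤ; 1ℤ; -1ℤ; ∣_∣)
import Data.Integer.Properties as ℤ
import Data.Integer.DivMod as ℤ
import Data.Integer.Divisibility.Signed as ℤ
open import Data.Integer.Tactic.RingSolver using (solve-∀)
open import Data.Fin as Fin using (Fin; toℕ; fromℕ<; punchOut)
import Data.Fin.Properties as Fin
open import Data.Bool using (Bool; true; false; if_then_else_; _∧_; T)
open import Data.Unit using (tt)
open import Data.List using ([]; _∷_; _++_; map; concat; concatMap; applyUpTo; upTo)
import Data.List.Properties as List
open import Data.Product using (_×_; _,_; proj₁; proj₂; ∃-syntax)
open import Data.Sum using (_⊎_; inj₁; inj₂)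
open import Function using (_∘_; id; _⇔_; mk⇔)
open import Function.Definitions using (Injective)
open import Relation.Nullary using (¬_; Dec; yes; no; contradiction)
open import Relation.Nullary.Decidable using (⌊_⌋; isYes≗does; dec-true; dec-false; does-⇔)
open import Relation.Binary using (IsEquivalence; Setoid)
open import Relation.Binary.PropositionalEquality
import Relation.Binary.Reasoning.Setoid as SetoidReasoning

-- The integer operations are opened only in this block: the statement of lemma4p3 uses ℕ's _*_ unqualified.
module _ where

  open import Data.Integer using (-_; _+_; _*_; _-_)

  ∑ : ℕ → (ℕ → ℤ) → ℤ
  ∑ zero    f = 0ℤ
  ∑ (suc n) f = f 0 + ∑ n (f ∘ suc)

  syntax ∑ n (λ i → e) = ∑[ i < n ] e

  ∑-cong< : ∀ n {f g : ℕ → ℤ} → (∀ i → i < n → f i ≡ g i) → ∑ n f ≡ ∑ n g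
  ∑-cong< zero    eq = refl
  ∑-cong< (suc n) eq = cong₂ _+_ (eq 0 (s≤s z≤n)) (∑-cong< n λ i i<n → eq (suc i) (s≤s i<n))

  ∑-cong : ∀ n {f g : ℕ → ℤ} → (∀ i → f i ≡ g i) → ∑ n f ≡ ∑ n g
  ∑-cong n eq = ∑-cong< n λ i _ → eq i

  ∑-zero : ∀ n → ∑[ i < n ] 0ℤ ≡ 0ℤ
  ∑-zero zero    = refl
  ∑-zero (suc n) = trans (ℤ.+-identityˡ _) (∑-zero n)

  ∑-const : ∀ n c → ∑[ i < n ] c ≡ + n * c
  ∑-const zero    c = sym (ℤ.*-zeroˡ c)
  ∑-const (suc n) c = trans (cong (_+_ c) (∑-const n c)) (lemma c (+ n))
    where
    lemma : ∀ c m → c + m * c ≡ (1ℤ + m) * c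
    lemma = solve-∀

  ∑-distrib-+ : ∀ n (f g : ℕ → ℤ) → ∑[ i < n ] (f i + g i) ≡ ∑ n f + ∑ n g
  ∑-distrib-+ zero    f g = refl
  ∑-distrib-+ (suc n) f g =
    trans (cong (_+_ (f 0 + g 0)) (∑-distrib-+ n (f ∘ suc) (g ∘ suc))) (lemma (f 0) (g 0) _ _)
    where
    lemma : ∀ a b c d → a + b + (c + d) ≡ a + c + (b + d)
    lemma = solve-∀

  *-distribˡ-∑ : ∀ n c (f : ℕ → ℤ) → c * ∑ n f ≡ ∑[ i < n ] (c * f i)
  *-distribˡ-∑ zero    c f = ℤ.*-zeroʳ c
  *-distribˡ-∑ (suc n) c f = trans (ℤ.*-distribˡ-+ c (f 0) _) (cong (_+_ (c * f 0)) (*-distribˡ-∑ n c (f ∘ suc)))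

  *-distribʳ-∑ : ∀ n c (f : ℕ → ℤ) → ∑ n f * c ≡ ∑[ i < n ] (f i * c)
  *-distribʳ-∑ n c f = trans (ℤ.*-comm _ c) (trans (*-distribˡ-∑ n c f) (∑-cong n λ i → ℤ.*-comm c (f i)))

  ∑-distrib-- : ∀ n (f g : ℕ → ℤ) → ∑[ i < n ] (f i - g i) ≡ ∑ n f - ∑ n g
  ∑-distrib-- n f g = begin
    ∑[ i < n ] (f i - g i)          ≡⟨ ∑-distrib-+ n f (λ i → - g i) ⟩
    ∑ n f + ∑[ i < n ] (- g i)      ≡⟨ cong (_+_ (∑ n f)) (∑-cong n λ i → sym (ℤ.-1*i≡-i (g i))) ⟩
    ∑ n f + ∑[ i < n ] (-1ℤ * g i) ≡⟨ cong (_+_ (∑ n f)) (sym (*-distribˡ-∑ n -1ℤ g)) ⟩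
    ∑ n f + -1ℤ * ∑ n g            ≡⟨ cong (_+_ (∑ n f)) (ℤ.-1*i≡-i (∑ n g)) ⟩
    ∑ n f - ∑ n g                    ∎
    where open ≡-Reasoning

  ∑-comm : ∀ m n (f : ℕ → ℕ → ℤ) → ∑[ i < m ] ∑[ j < n ] f i j ≡ ∑[ j < n ] ∑[ i < m ] f i j
  ∑-comm zero    n f = sym (∑-zero n)
  ∑-comm (suc m) n f = trans (cong (_+_ (∑ n (f 0))) (∑-comm m n (f ∘ suc)))
                             (sym (∑-distrib-+ n (f 0) λ j → ∑[ i < m ] f (suc i) j))

  ∑-split : ∀ m n (f : ℕ → ℤ) → ∑ (m ℕ.+ n) f ≡ ∑ m f + ∑[ i < n ] f (m ℕ.+ i)
  ∑-split zero    n f = sym (ℤ.+-identityˡ _)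
  ∑-split (suc m) n f = trans (cong (_+_ (f 0)) (∑-split m n (f ∘ suc))) (sym (ℤ.+-assoc (f 0) _ _))

  ∑-block : ∀ m n (f : ℕ → ℤ) → ∑ (m ℕ.* n) f ≡ ∑[ i < m ] ∑[ r < n ] f (i ℕ.* n ℕ.+ r)
  ∑-block zero    n f = refl
  ∑-block (suc m) n f = trans (∑-split n (m ℕ.* n) f) (cong (_+_ (∑ n f)) (begin
    ∑[ i < m ℕ.* n ] f (n ℕ.+ i)                       ≡⟨ ∑-block m n (λ i → f (n ℕ.+ i)) ⟩
    ∑[ i < m ] ∑[ r < n ] f (n ℕ.+ (i ℕ.* n ℕ.+ r))      ≡⟨ ∑-cong m (λ i → ∑-cong n λ r → cong f (sym (ℕ.+-assoc n _ r))) ⟩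
    ∑[ i < m ] ∑[ r < n ] f (suc i ℕ.* n ℕ.+ r)          ∎))
    where open ≡-Reasoning

  ∑-telescope : ∀ n (g : ℕ → ℤ) → ∑[ i < n ] g (suc i) - ∑ n g ≡ g n - g 0
  ∑-telescope zero    g = sym (ℤ.+-inverseʳ (g 0))
  ∑-telescope (suc n) g = begin
    g 1 + ∑[ i < n ] g (suc (suc i)) - (g 0 + ∑[ i < n ] g (suc i))  ≡⟨ lemma₁ (g 1) (g 0) _ _ ⟩
    g 1 - g 0 + (∑[ i < n ] g (suc (suc i)) - ∑[ i < n ] g (suc i))  ≡⟨ cong (_+_ (g 1 - g 0)) (∑-telescope n (g ∘ suc)) ⟩
    g 1 - g 0 + (g (suc n) - g 1)                                    ≡⟨ lemma₂ (g 1) (g 0) (g (suc n)) ⟩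
    g (suc n) - g 0                                                  ∎
    where
    open ≡-Reasoning
    lemma₁ : ∀ a b c d → a + c - (b + d) ≡ a - b + (c - d)
    lemma₁ = solve-∀
    lemma₂ : ∀ a b c → a - b + (c - a) ≡ c - b
    lemma₂ = solve-∀

  ⌊⌋-true : ∀ {A : Set} (d : Dec A) → A → ⌊ d ⌋ ≡ true
  ⌊⌋-true d a = trans (isYes≗does d) (dec-true d a)

  ⌊⌋-false : ∀ {A : Set} (d : Dec A) → ¬ A → ⌊ d ⌋ ≡ false
  ⌊⌋-false d ¬a = trans (isYes≗does d) (dec-false d ¬a)

  𝟙 : {A : Set} → Dec A → ℤ
  𝟙 d = if ⌊ d ⌋ then 1ℤ else 0ℤ

  𝟙-yes : ∀ {A : Set} (d : Dec A) → A → 𝟙 d ≡ 1ℤ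
  𝟙-yes d a = cong (if_then 1ℤ else 0ℤ) (⌊⌋-true d a)

  𝟙-no : ∀ {A : Set} (d : Dec A) → ¬ A → 𝟙 d ≡ 0ℤ
  𝟙-no d ¬a = cong (if_then 1ℤ else 0ℤ) (⌊⌋-false d ¬a)

  𝟙-cong : ∀ {A B : Set} (dA : Dec A) (dB : Dec B) → A ⇔ B → 𝟙 dA ≡ 𝟙 dB
  𝟙-cong dA dB A⇔B = cong (if_then 1ℤ else 0ℤ)
    (trans (isYes≗does dA) (trans (does-⇔ A⇔B dA dB) (sym (isYes≗does dB))))

  ∑-𝟙-pick : ∀ n u (g : ℕ → ℤ) → u < n → ∑[ v < n ] (𝟙 (u ℕ.≟ v) * g v) ≡ g u
  ∑-𝟙-pick (suc n) zero    g _ = begin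
    1ℤ * g 0 + ∑[ v < n ] (𝟙 (0 ℕ.≟ suc v) * g (suc v))
      ≡⟨ cong₂ _+_ (ℤ.*-identityˡ (g 0)) (∑-cong n λ v → ℤ.*-zeroˡ (g (suc v))) ⟩
    g 0 + ∑[ v < n ] 0ℤ
      ≡⟨ cong (_+_ (g 0)) (∑-zero n) ⟩
    g 0 + 0ℤ
      ≡⟨ ℤ.+-identityʳ (g 0) ⟩
    g 0 ∎
    where open ≡-Reasoning
  ∑-𝟙-pick (suc n) (suc u) g (s≤s u<n) = begin
    0ℤ * g 0 + ∑[ v < n ] (𝟙 (suc u ℕ.≟ suc v) * g (suc v))
      ≡⟨ cong₂ _+_ (ℤ.*-zeroˡ (g 0)) (∑-cong n λ v → cong (_* g (suc v)) (𝟙-cong (suc u ℕ.≟ suc v) (u ℕ.≟ v) suc-≡⇔)) ⟩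
    0ℤ + ∑[ v < n ] (𝟙 (u ℕ.≟ v) * g (suc v))
      ≡⟨ ℤ.+-identityˡ _ ⟩
    ∑[ v < n ] (𝟙 (u ℕ.≟ v) * g (suc v))
      ≡⟨ ∑-𝟙-pick n u (g ∘ suc) u<n ⟩
    g (suc u) ∎
    where
    open ≡-Reasoning
    suc-≡⇔ : ∀ {v} → suc u ≡ suc v ⇔ u ≡ v
    suc-≡⇔ = mk⇔ ℕ.suc-injective (cong suc)

  ∑-multiples : ∀ m d .{{_ : NonZero d}} (f : ℕ → ℤ) →
                ∑[ t < m ℕ.* d ] (if ⌊ d ∣? t ⌋ then f t else 0ℤ) ≡ ∑[ i < m ] f (i ℕ.* d)
  ∑-multiples m d@(suc d′) f = trans (∑-block m d h) (∑-cong m block)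
    where
    h : ℕ → ℤ
    h t = if ⌊ d ∣? t ⌋ then f t else 0ℤ
    d∤ : ∀ i r → r < d′ → ¬ d ∣ i ℕ.* d ℕ.+ suc r
    d∤ i r r<d′ d∣ = ℕ.<⇒≱ (s≤s r<d′) (∣⇒≤ (∣m+n∣m⇒∣n d∣ (n∣m*n i)))
    block : ∀ i → ∑[ r < d ] h (i ℕ.* d ℕ.+ r) ≡ f (i ℕ.* d)
    block i = begin
      h (i ℕ.* d ℕ.+ 0) + ∑[ r < d′ ] h (i ℕ.* d ℕ.+ suc r)
        ≡⟨ cong₂ _+_ (cong (if_then f (i ℕ.* d ℕ.+ 0) else 0ℤ) (⌊⌋-true (d ∣? _) (subst (d ∣_) (sym (ℕ.+-identityʳ _)) (n∣m*n i))))
                     (∑-cong< d′ λ r r<d′ → cong (if_then f (i ℕ.* d ℕ.+ suc r) else 0ℤ) (⌊⌋-false (d ∣? _) (d∤ i r r<d′))) ⟩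
      f (i ℕ.* d ℕ.+ 0) + ∑[ r < d′ ] 0ℤ
        ≡⟨ cong₂ _+_ (cong f (ℕ.+-identityʳ _)) (∑-zero d′) ⟩
      f (i ℕ.* d) + 0ℤ
        ≡⟨ ℤ.+-identityʳ _ ⟩
      f (i ℕ.* d) ∎
      where open ≡-Reasoning

  Fin-injective⇒surjective : ∀ {n} (F : Fin n → Fin n) → Injective _≡_ _≡_ F → ∀ w → ∃[ i ] F i ≡ w
  Fin-injective⇒surjective {suc m} F F-inj w with Fin.any? (λ i → F i Fin.≟ w)
  ... | yes hit = hit
  ... | no ¬hit = contradiction (Fin.injective⇒≤ F′-inj) ℕ.1+n≰n
    where
    w≢F : ∀ i → w ≢ F i
    w≢F i w≡Fi = ¬hit (i , sym w≡Fi)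
    F′ : Fin (suc m) → Fin m
    F′ i = punchOut (w≢F i)
    F′-inj : Injective _≡_ _≡_ F′
    F′-inj {i} {j} eq = F-inj (Fin.punchOut-injective (w≢F i) (w≢F j) eq)

  module _ {n : ℕ} (σ : ℕ → ℕ) (σ< : ∀ {i} → i < n → σ i < n)
           (σ-inj : ∀ {i j} → i < n → j < n → σ i ≡ σ j → i ≡ j) where

    private
      Fσ : Fin n → Fin n
      Fσ i = fromℕ< (σ< (Fin.toℕ<n i))

      toℕ-Fσ : ∀ i → toℕ (Fσ i) ≡ σ (toℕ i)
      toℕ-Fσ i = Fin.toℕ-fromℕ< (σ< (Fin.toℕ<n i))

      Fσ-inj : Injective _≡_ _≡_ Fσ
      Fσ-inj {i} {j} eq = Fin.toℕ-injective
        (σ-inj (Fin.toℕ<n i) (Fin.toℕ<n j) (trans (sym (toℕ-Fσ i)) (trans (cong toℕ eq) (toℕ-Fσ j))))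

    <-injective⇒surjective : ∀ {v} → v < n → ∃[ u ] u < n × σ u ≡ v
    <-injective⇒surjective v<n with Fin-injective⇒surjective Fσ Fσ-inj (fromℕ< v<n)
    ... | i , Fσi≡v = toℕ i , Fin.toℕ<n i , trans (sym (toℕ-Fσ i)) (trans (cong toℕ Fσi≡v) (Fin.toℕ-fromℕ< v<n))

    ∑-permute : ∀ (g : ℕ → ℤ) → ∑[ i < n ] g (σ i) ≡ ∑ n g
    ∑-permute g = begin
      ∑[ i < n ] g (σ i)                              ≡⟨ ∑-cong< n (λ i i<n → sym (∑-𝟙-pick n (σ i) g (σ< i<n))) ⟩
      ∑[ i < n ] ∑[ v < n ] (𝟙 (σ i ℕ.≟ v) * g v)     ≡⟨ ∑-comm n n _ ⟩
      ∑[ v < n ] ∑[ i < n ] (𝟙 (σ i ℕ.≟ v) * g v)     ≡⟨ ∑-cong n (λ v → sym (*-distribʳ-∑ n (g v) _)) ⟩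
      ∑[ v < n ] (∑[ i < n ] 𝟙 (σ i ℕ.≟ v) * g v)     ≡⟨ ∑-cong< n (λ v v<n → cong (_* g v) (preimage-count v<n)) ⟩
      ∑[ v < n ] (1ℤ * g v)                           ≡⟨ ∑-cong n (λ v → ℤ.*-identityˡ (g v)) ⟩
      ∑ n g                                           ∎
      where
      open ≡-Reasoning
      preimage-count : ∀ {v} → v < n → ∑[ i < n ] 𝟙 (σ i ℕ.≟ v) ≡ 1ℤ
      preimage-count {v} v<n with <-injective⇒surjective v<n
      ... | u , u<n , σu≡v = begin
        ∑[ i < n ] 𝟙 (σ i ℕ.≟ v)
          ≡⟨ ∑-cong< n (λ i i<n → trans (𝟙-cong (σ i ℕ.≟ v) (u ℕ.≟ i) (σ≡v⇔ i<n)) (sym (ℤ.*-identityʳ _))) ⟩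
        ∑[ i < n ] (𝟙 (u ℕ.≟ i) * 1ℤ)
          ≡⟨ ∑-𝟙-pick n u (λ _ → 1ℤ) u<n ⟩
        1ℤ ∎
        where
        σ≡v⇔ : ∀ {i} → i < n → σ i ≡ v ⇔ u ≡ i
        σ≡v⇔ i<n = mk⇔ (λ σi≡v → σ-inj u<n i<n (trans σu≡v (sym σi≡v))) (λ u≡i → trans (cong σ (sym u≡i)) σu≡v)

  if-∑ : ∀ (b : Bool) n (f : ℕ → ℤ) → (if b then 0ℤ else ∑ n f) ≡ ∑[ j < n ] (if b then 0ℤ else f j)
  if-∑ true  n f = sym (∑-zero n)
  if-∑ false n f = refl

  if-as-𝟙 : ∀ (b : Bool) c → (if b then c else 0ℤ) ≡ c * (if b then 1ℤ else 0ℤ)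
  if-as-𝟙 true  c = sym (ℤ.*-identityʳ c)
  if-as-𝟙 false c = sym (ℤ.*-zeroʳ c)

  𝟙-shift : ∀ a b r → 𝟙 (a ℤ.≟ r - b) ≡ 𝟙 (b + a ℤ.≟ r)
  𝟙-shift a b r = 𝟙-cong (a ℤ.≟ r - b) (b + a ℤ.≟ r) (mk⇔ (λ eq → trans (cong (_+_ b) eq) (lemma₁ b r))
                                                           (λ eq → trans (sym (lemma₂ b a)) (cong (_- b) eq)))
    where
    lemma₁ : ∀ b r → b + (r - b) ≡ r
    lemma₁ = solve-∀
    lemma₂ : ∀ b a → b + a - b ≡ a
    lemma₂ = solve-∀

  coeff-++ : ∀ xs ys r → coeff (xs ++ ys) r ≡ coeff xs r + coeff ys r
  coeff-++ []             ys r = sym (ℤ.+-identityˡ _)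
  coeff-++ ((c , s) ∷ xs) ys r = trans (cong (_+_ x) (coeff-++ xs ys r)) (sym (ℤ.+-assoc x (coeff xs r) (coeff ys r)))
    where
    x : ℤ
    x = if ⌊ s ℤ.≟ r ⌋ then c else 0ℤ

  coeff-eN : ∀ s r → coeff (eN s) r ≡ 𝟙 (s ℤ.≟ r)
  coeff-eN s r = ℤ.+-identityʳ _

  coeff-const : ∀ c r → coeff (const c) r ≡ c * 𝟙 (0ℤ ℤ.≟ r)
  coeff-const c r = trans (ℤ.+-identityʳ _) (if-as-𝟙 _ c)

  coeff-if : ∀ (b : Bool) x r → coeff (if b then [] else x) r ≡ (if b then 0ℤ else coeff x r)
  coeff-if true  x r = refl
  coeff-if false x r = refl

  Σ<-suc : ∀ n (f : ℕ → Cyc) → Σ< (suc n) f ≡ f 0 ++ Σ< n (f ∘ suc)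
  Σ<-suc n f = cong (λ xs → f 0 ++ concat xs) (trans (List.map-applyUpTo suc f n) (sym (List.map-applyUpTo id (f ∘ suc) n)))

  coeff-Σ< : ∀ n (f : ℕ → Cyc) r → coeff (Σ< n f) r ≡ ∑[ i < n ] coeff (f i) r
  coeff-Σ< zero    f r = refl
  coeff-Σ< (suc n) f r = begin
    coeff (Σ< (suc n) f) r                  ≡⟨ cong (λ xs → coeff xs r) (Σ<-suc n f) ⟩
    coeff (f 0 ++ Σ< n (f ∘ suc)) r         ≡⟨ coeff-++ (f 0) _ r ⟩
    coeff (f 0) r + coeff (Σ< n (f ∘ suc)) r ≡⟨ cong (_+_ (coeff (f 0) r)) (coeff-Σ< n (f ∘ suc) r) ⟩
    ∑[ i < suc n ] coeff (f i) r            ∎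
    where open ≡-Reasoning

  coeff-singleton-⊗ : ∀ c s ys r → coeff (((c , s) ∷ []) ⊗ ys) r ≡ c * coeff ys (r - s)
  coeff-singleton-⊗ c s []             r = sym (ℤ.*-zeroʳ c)
  coeff-singleton-⊗ c s ((d , t) ∷ ys) r = begin
    (if ⌊ s + t ℤ.≟ r ⌋ then c * d else 0ℤ) + coeff (((c , s) ∷ []) ⊗ ys) r
      ≡⟨ cong₂ _+_ (if-as-𝟙 _ (c * d)) (coeff-singleton-⊗ c s ys r) ⟩
    c * d * 𝟙 (s + t ℤ.≟ r) + c * coeff ys (r - s)
      ≡⟨ cong (λ z → c * d * z + c * coeff ys (r - s)) (sym (𝟙-shift t s r)) ⟩
    c * d * 𝟙 (t ℤ.≟ r - s) + c * coeff ys (r - s)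
      ≡⟨ trans (cong (_+ c * coeff ys (r - s)) (ℤ.*-assoc c d _)) (sym (ℤ.*-distribˡ-+ c _ _)) ⟩
    c * (d * 𝟙 (t ℤ.≟ r - s) + coeff ys (r - s))
      ≡⟨ cong (λ z → c * (z + coeff ys (r - s))) (sym (if-as-𝟙 _ d)) ⟩
    c * coeff ((d , t) ∷ ys) (r - s) ∎
    where open ≡-Reasoning

  coeff-⊗ : ∀ xs ys r → coeff (xs ⊗ ys) r ≡ sumℤ (map (λ x → proj₁ x * coeff ys (r - proj₂ x)) xs)
  coeff-⊗ xs ys r = coeff-concatMap _ (λ { (c , s) → coeff-singleton-⊗ c s ys r }) xs
    where
    coeff-concatMap : ∀ {A : Set} (F : A → Cyc) {g : A → ℤ} → (∀ x → coeff (F x ++ []) r ≡ g x) →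
                      ∀ xs → coeff (concatMap F xs) r ≡ sumℤ (map g xs)
    coeff-concatMap F eq []       = refl
    coeff-concatMap F eq (x ∷ xs) = trans (coeff-++ (F x) (concatMap F xs) r)
      (cong₂ _+_ (trans (cong (λ ys → coeff ys r) (sym (List.++-identityʳ (F x)))) (eq x)) (coeff-concatMap F eq xs))

  coeff-∷-⊗ : ∀ c s xs ys r → coeff (((c , s) ∷ xs) ⊗ ys) r ≡ c * coeff ys (r - s) + coeff (xs ⊗ ys) r
  coeff-∷-⊗ c s xs ys r = trans (coeff-⊗ ((c , s) ∷ xs) ys r) (cong (_+_ (c * coeff ys (r - s))) (sym (coeff-⊗ xs ys r)))

  coeff-++-⊗ : ∀ xs ys zs r → coeff ((xs ++ ys) ⊗ zs) r ≡ coeff (xs ⊗ zs) r + coeff (ys ⊗ zs) r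
  coeff-++-⊗ []             ys zs r = sym (ℤ.+-identityˡ _)
  coeff-++-⊗ ((c , s) ∷ xs) ys zs r = begin
    coeff (((c , s) ∷ xs ++ ys) ⊗ zs) r
      ≡⟨ coeff-∷-⊗ c s (xs ++ ys) zs r ⟩
    c * coeff zs (r - s) + coeff ((xs ++ ys) ⊗ zs) r
      ≡⟨ cong (_+_ (c * coeff zs (r - s))) (coeff-++-⊗ xs ys zs r) ⟩
    c * coeff zs (r - s) + (coeff (xs ⊗ zs) r + coeff (ys ⊗ zs) r)
      ≡⟨ sym (ℤ.+-assoc (c * coeff zs (r - s)) (coeff (xs ⊗ zs) r) _) ⟩
    c * coeff zs (r - s) + coeff (xs ⊗ zs) r + coeff (ys ⊗ zs) r
      ≡⟨ cong (_+ coeff (ys ⊗ zs) r) (sym (coeff-∷-⊗ c s xs zs r)) ⟩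
    coeff (((c , s) ∷ xs) ⊗ zs) r + coeff (ys ⊗ zs) r ∎
    where open ≡-Reasoning

  negate : Cyc → Cyc
  negate []            = []
  negate ((c , s) ∷ q) = (- c , s) ∷ negate q

  coeff-negate-⊗ : ∀ q ys r → coeff (negate q ⊗ ys) r ≡ - coeff (q ⊗ ys) r
  coeff-negate-⊗ []            ys r = refl
  coeff-negate-⊗ ((c , s) ∷ q) ys r = begin
    coeff (((- c , s) ∷ negate q) ⊗ ys) r          ≡⟨ coeff-∷-⊗ (- c) s (negate q) ys r ⟩
    - c * coeff ys (r - s) + coeff (negate q ⊗ ys) r ≡⟨ cong (_+_ (- c * coeff ys (r - s))) (coeff-negate-⊗ q ys r) ⟩
    - c * coeff ys (r - s) + - coeff (q ⊗ ys) r      ≡⟨ lemma c (coeff ys (r - s)) _ ⟩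
    - (c * coeff ys (r - s) + coeff (q ⊗ ys) r)      ≡⟨ cong -_ (sym (coeff-∷-⊗ c s q ys r)) ⟩
    - coeff (((c , s) ∷ q) ⊗ ys) r                 ∎
    where
    open ≡-Reasoning
    lemma : ∀ c x y → - c * x + - y ≡ - (c * x + y)
    lemma = solve-∀

  coeff-eN-⊗ : ∀ u ys r → coeff (eN u ⊗ ys) r ≡ coeff ys (r - u)
  coeff-eN-⊗ u ys r = trans (coeff-singleton-⊗ 1ℤ u ys r) (ℤ.*-identityˡ _)

  coeff-Σ<eN-⊗ : ∀ n (f : ℕ → ℤ) ys r → coeff (Σ< n (λ j → eN (f j)) ⊗ ys) r ≡ ∑[ j < n ] coeff ys (r - f j)
  coeff-Σ<eN-⊗ zero    f ys r = refl
  coeff-Σ<eN-⊗ (suc n) f ys r = begin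
    coeff (Σ< (suc n) (eN ∘ f) ⊗ ys) r
      ≡⟨ cong (λ xs → coeff (xs ⊗ ys) r) (Σ<-suc n (eN ∘ f)) ⟩
    coeff ((eN (f 0) ++ Σ< n (eN ∘ f ∘ suc)) ⊗ ys) r
      ≡⟨ coeff-++-⊗ (eN (f 0)) (Σ< n (eN ∘ f ∘ suc)) ys r ⟩
    coeff (eN (f 0) ⊗ ys) r + coeff (Σ< n (eN ∘ f ∘ suc) ⊗ ys) r
      ≡⟨ cong₂ _+_ (coeff-eN-⊗ (f 0) ys r) (coeff-Σ<eN-⊗ n (f ∘ suc) ys r) ⟩
    ∑[ j < suc n ] coeff ys (r - f j) ∎
    where open ≡-Reasoning

  sumℤ-upTo : ∀ n (g : ℕ → ℤ) → sumℤ (map g (upTo n)) ≡ ∑ n g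
  sumℤ-upTo n g = trans (cong sumℤ (List.map-applyUpTo id g n)) (sumℤ-applyUpTo n g)
    where
    sumℤ-applyUpTo : ∀ n (g : ℕ → ℤ) → sumℤ (applyUpTo g n) ≡ ∑ n g
    sumℤ-applyUpTo zero    g = refl
    sumℤ-applyUpTo (suc n) g = cong (_+_ (g 0)) (sumℤ-applyUpTo n (g ∘ suc))

  coeff-Σ<-eN : ∀ n (f : ℕ → ℤ) r → coeff (Σ< n (λ i → eN (f i))) r ≡ ∑[ i < n ] 𝟙 (f i ℤ.≟ r)
  coeff-Σ<-eN n f r = trans (coeff-Σ< n (eN ∘ f) r) (∑-cong n λ i → coeff-eN (f i) r)

  coeff-Σ<-if-eN : ∀ n (b : ℕ → Bool) (f : ℕ → ℤ) r →
                   coeff (Σ< n (λ t → if b t then [] else eN (f t))) r ≡ ∑[ t < n ] (if b t then 0ℤ else 𝟙 (f t ℤ.≟ r))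
  coeff-Σ<-if-eN n b f r = trans (coeff-Σ< n _ r) (∑-cong n λ t →
    trans (coeff-if (b t) (eN (f t)) r) (cong (λ z → if b t then 0ℤ else z) (coeff-eN (f t) r)))

  infixr 7 _⊙_
  _⊙_ : ℕ → Cyc → Cyc
  n ⊙ x = Σ< n (λ _ → x)

  coeff-⊙ : ∀ n x r → coeff (n ⊙ x) r ≡ + n * coeff x r
  coeff-⊙ n x r = trans (coeff-Σ< n (λ _ → x) r) (∑-const n (coeff x r))

  module Cyclotomic (p k′ : ℕ) where

    k P D : ℕ
    k = suc k′
    P = p ^ k
    D = p ^ k′

    -- A record rather than a synonym, so that x and y can be inferred from a proof of x ≈ y.
    infix 4 _≈_
    record _≈_ (x y : Cyc) : Set where
      constructor wrap
      field unwrap : x ≈[ p ^ k ] y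
    open _≈_ public

    private
      qΦ : Cyc → ℤ → ℤ
      qΦ q r = coeff (q ⊗ Φ p k) r

    ≈-by-coeff : ∀ {x y} → (∀ r → coeff x r ≡ coeff y r) → x ≈ y
    ≈-by-coeff eq = wrap ([] , λ r → trans (eq r) (sym (ℤ.+-identityʳ _)))

    ≈-reflexive : ∀ {x y} → x ≡ y → x ≈ y
    ≈-reflexive refl = ≈-by-coeff λ _ → refl

    ≈-refl : ∀ {x} → x ≈ x
    ≈-refl = ≈-reflexive refl

    ≈-sym : ∀ {x y} → x ≈ y → y ≈ x
    ≈-sym {x} {y} (wrap (q , eq)) = wrap (negate q , λ r → begin
      coeff y r                         ≡⟨ lemma (coeff y r) (qΦ q r) ⟩
      coeff y r + qΦ q r - qΦ q r       ≡⟨ cong (_- qΦ q r) (sym (eq r)) ⟩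
      coeff x r - qΦ q r                ≡⟨ cong (_+_ (coeff x r)) (sym (coeff-negate-⊗ q (Φ p k) r)) ⟩
      coeff x r + qΦ (negate q) r       ∎)
      where
      open ≡-Reasoning
      lemma : ∀ a b → a ≡ a + b - b
      lemma = solve-∀

    ≈-trans : ∀ {x y z} → x ≈ y → y ≈ z → x ≈ z
    ≈-trans {x} {y} {z} (wrap (q₁ , eq₁)) (wrap (q₂ , eq₂)) = wrap (q₂ ++ q₁ , λ r → begin
      coeff x r                          ≡⟨ eq₁ r ⟩
      coeff y r + qΦ q₁ r                ≡⟨ cong (_+ qΦ q₁ r) (eq₂ r) ⟩
      coeff z r + qΦ q₂ r + qΦ q₁ r      ≡⟨ ℤ.+-assoc (coeff z r) _ _ ⟩
      coeff z r + (qΦ q₂ r + qΦ q₁ r)    ≡⟨ cong (_+_ (coeff z r)) (sym (coeff-++-⊗ q₂ q₁ (Φ p k) r)) ⟩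
      coeff z r + qΦ (q₂ ++ q₁) r        ∎)
      where open ≡-Reasoning

    ≈-isEquivalence : IsEquivalence _≈_
    ≈-isEquivalence = record { refl = ≈-refl ; sym = ≈-sym ; trans = ≈-trans }

    ≈-setoid : Setoid _ _
    ≈-setoid = record { isEquivalence = ≈-isEquivalence }

    module ≈-Reasoning = SetoidReasoning ≈-setoid

    ++-cong : ∀ {x₁ y₁ x₂ y₂} → x₁ ≈ y₁ → x₂ ≈ y₂ → x₁ ++ x₂ ≈ y₁ ++ y₂
    ++-cong {x₁} {y₁} {x₂} {y₂} (wrap (q₁ , eq₁)) (wrap (q₂ , eq₂)) = wrap (q₁ ++ q₂ , λ r → begin
      coeff (x₁ ++ x₂) r                               ≡⟨ coeff-++ x₁ x₂ r ⟩
      coeff x₁ r + coeff x₂ r                          ≡⟨ cong₂ _+_ (eq₁ r) (eq₂ r) ⟩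
      coeff y₁ r + qΦ q₁ r + (coeff y₂ r + qΦ q₂ r)    ≡⟨ lemma (coeff y₁ r) (qΦ q₁ r) (coeff y₂ r) (qΦ q₂ r) ⟩
      coeff y₁ r + coeff y₂ r + (qΦ q₁ r + qΦ q₂ r)    ≡⟨ sym (cong₂ _+_ (coeff-++ y₁ y₂ r) (coeff-++-⊗ q₁ q₂ (Φ p k) r)) ⟩
      coeff (y₁ ++ y₂) r + qΦ (q₁ ++ q₂) r             ∎)
      where
      open ≡-Reasoning
      lemma : ∀ a b c d → a + b + (c + d) ≡ a + c + (b + d)
      lemma = solve-∀

    Σ<-cong< : ∀ n {f g : ℕ → Cyc} → (∀ i → i < n → f i ≈ g i) → Σ< n f ≈ Σ< n g
    Σ<-cong< zero    eq = ≈-refl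
    Σ<-cong< (suc n) {f} {g} eq = begin
      Σ< (suc n) f            ≡⟨ Σ<-suc n f ⟩
      f 0 ++ Σ< n (f ∘ suc)   ≈⟨ ++-cong (eq 0 (s≤s z≤n)) (Σ<-cong< n λ i i<n → eq (suc i) (s≤s i<n)) ⟩
      g 0 ++ Σ< n (g ∘ suc)   ≡⟨ Σ<-suc n g ⟨
      Σ< (suc n) g            ∎
      where open ≈-Reasoning

    Σ<-cong : ∀ n {f g : ℕ → Cyc} → (∀ i → f i ≈ g i) → Σ< n f ≈ Σ< n g
    Σ<-cong n eq = Σ<-cong< n λ i _ → eq i

    if-cong : ∀ (b : Bool) {x y} → x ≈ y → (if b then [] else x) ≈ (if b then [] else y)
    if-cong true  _   = ≈-refl
    if-cong false x≈y = x≈y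

    coeff-Φ : ∀ u → coeff (Φ p k) u ≡ ∑[ i < p ] 𝟙 (+ (i ℕ.* D) ℤ.≟ u)
    coeff-Φ u = coeff-Σ<-eN p (λ i → + (i ℕ.* D)) u

    -- x^(s+P) - x^s = (x^(s+D) - x^s) Φ(x), whose coefficients telescope.
    eN-+P : ∀ s → eN (s + + P) ≈ eN s
    eN-+P s = wrap (q , λ r → begin
      coeff (eN (s + + P)) r
        ≡⟨ trans (coeff-eN _ r) (sym (𝟙-shift (+ P) s r)) ⟩
      g r p
        ≡⟨ lemma (g r p) (g r 0) ⟩
      g r 0 + (g r p - g r 0)
        ≡⟨ cong₂ _+_ (g₀ r) (sym (∑-telescope p (g r))) ⟩
      coeff (eN s) r + (∑[ i < p ] g r (suc i) - ∑ p (g r))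
        ≡⟨ cong₂ (λ a b → coeff (eN s) r + (a - b)) (sym (coeff-Φ-shifted r)) (sym (coeff-Φ (r - s))) ⟩
      coeff (eN s) r + (Φ[ r - (s + + D) ] - Φ[ r - s ])
        ≡⟨ cong (_+_ (coeff (eN s) r)) (sym (coeff-q⊗Φ r)) ⟩
      coeff (eN s) r + coeff (q ⊗ Φ p k) r ∎)
      where
      open ≡-Reasoning
      q : Cyc
      q = (1ℤ , s + + D) ∷ (-1ℤ , s) ∷ []
      Φ[_] : ℤ → ℤ
      Φ[ u ] = coeff (Φ p k) u
      g : ℤ → ℕ → ℤ
      g r i = 𝟙 (+ (i ℕ.* D) ℤ.≟ r - s)
      lemma : ∀ a b → a ≡ b + (a - b)
      lemma = solve-∀
      coeff-q⊗Φ : ∀ r → coeff (q ⊗ Φ p k) r ≡ Φ[ r - (s + + D) ] - Φ[ r - s ]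
      coeff-q⊗Φ r = trans (coeff-∷-⊗ 1ℤ (s + + D) ((-1ℤ , s) ∷ []) (Φ p k) r)
        (trans (cong (_+_ (1ℤ * Φ[ r - (s + + D) ])) (coeff-∷-⊗ -1ℤ s [] (Φ p k) r)) (lemma′ Φ[ r - (s + + D) ] Φ[ r - s ]))
        where
        lemma′ : ∀ a b → 1ℤ * a + (-1ℤ * b + 0ℤ) ≡ a - b
        lemma′ = solve-∀
      g₀ : ∀ r → g r 0 ≡ coeff (eN s) r
      g₀ r = trans (𝟙-shift 0ℤ s r) (trans (cong (λ z → 𝟙 (z ℤ.≟ r)) (ℤ.+-identityʳ s)) (sym (coeff-eN s r)))
      shift⇔ : ∀ i r → + (i ℕ.* D) ≡ r - (s + + D) ⇔ + (suc i ℕ.* D) ≡ r - s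
      shift⇔ i r = mk⇔ (λ eq → trans (ℤ.pos-+ D _) (trans (cong (_+_ (+ D)) eq) (lemma₁ (+ D) r s)))
                       (λ eq → trans (sym (lemma₂ (+ (i ℕ.* D)) (+ D))) (trans (cong (_- + D) (trans (sym (ℤ.pos-+ D _)) eq)) (lemma₃ r s (+ D))))
        where
        lemma₁ : ∀ d r s → d + (r - (s + d)) ≡ r - s
        lemma₁ = solve-∀
        lemma₂ : ∀ a d → d + a - d ≡ a
        lemma₂ = solve-∀
        lemma₃ : ∀ r s d → r - s - d ≡ r - (s + d)
        lemma₃ = solve-∀
      coeff-Φ-shifted : ∀ r → Φ[ r - (s + + D) ] ≡ ∑[ i < p ] g r (suc i)
      coeff-Φ-shifted r = trans (coeff-Φ _) (∑-cong p λ i → 𝟙-cong (_ ℤ.≟ r - (s + + D)) (_ ℤ.≟ r - s) (shift⇔ i r))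

    eN-periodic : ∀ s z → eN (s + + P * z) ≈ eN s
    eN-periodic s (+ n)    = eN-periodic⁺ s n
      where
      eN-periodic⁺ : ∀ s n → eN (s + + P * + n) ≈ eN s
      eN-periodic⁺ s zero    = ≈-reflexive (cong eN (trans (cong (_+_ s) (ℤ.*-zeroʳ (+ P))) (ℤ.+-identityʳ s)))
      eN-periodic⁺ s (suc n) = ≈-trans (≈-reflexive (cong eN (lemma s (+ P) (+ n)))) (≈-trans (eN-+P _) (eN-periodic⁺ s n))
        where
        lemma : ∀ s P n → s + P * (1ℤ + n) ≡ s + P * n + P
        lemma = solve-∀
    eN-periodic s -[1+ n ] = ≈-sym (≈-trans (≈-reflexive (cong eN (sym (lemma s (+ P) (+ suc n)))))
                                            (eN-periodic (s + + P * -[1+ n ]) (+ suc n)))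
      where
      lemma : ∀ s P n → s + P * (- n) + P * n ≡ s
      lemma = solve-∀

    eN-≡-mod : ∀ {s s′} z → s ≡ s′ + + P * z → eN s ≈ eN s′
    eN-≡-mod {s′ = s′} z refl = eN-periodic s′ z

    cyclotomic-relation : ∀ c → Σ< p (λ i → eN (c + + D * + i)) ≈ []
    cyclotomic-relation c = wrap (((1ℤ , c) ∷ []) , λ r → begin
      coeff (Σ< p (λ i → eN (c + + D * + i))) r
        ≡⟨ coeff-Σ<-eN p _ r ⟩
      ∑[ i < p ] 𝟙 (c + + D * + i ℤ.≟ r)
        ≡⟨ ∑-cong p (λ i → trans (cong (λ z → 𝟙 (c + z ℤ.≟ r)) (D*i≡ i)) (sym (𝟙-shift _ c r))) ⟩
      ∑[ i < p ] 𝟙 (+ (i ℕ.* D) ℤ.≟ r - c)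
        ≡⟨ sym (coeff-Φ (r - c)) ⟩
      coeff (Φ p k) (r - c)
        ≡⟨ sym (trans (ℤ.+-identityˡ _) (trans (coeff-singleton-⊗ 1ℤ c (Φ p k) r) (ℤ.*-identityˡ _))) ⟩
      0ℤ + coeff (((1ℤ , c) ∷ []) ⊗ Φ p k) r ∎)
      where
      open ≡-Reasoning
      D*i≡ : ∀ i → + D * + i ≡ + (i ℕ.* D)
      D*i≡ i = trans (ℤ.*-comm (+ D) (+ i)) (sym (ℤ.pos-* i D))

    const-Σ< : ∀ n (f : ℕ → ℤ) → Σ< n (λ i → const (f i)) ≈ const (∑ n f)
    const-Σ< n f = ≈-by-coeff λ r → begin
      coeff (Σ< n (λ i → const (f i))) r     ≡⟨ coeff-Σ< n _ r ⟩
      ∑[ i < n ] coeff (const (f i)) r       ≡⟨ ∑-cong n (λ i → coeff-const (f i) r) ⟩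
      ∑[ i < n ] (f i * 𝟙 (0ℤ ℤ.≟ r))         ≡⟨ sym (*-distribʳ-∑ n _ f) ⟩
      ∑ n f * 𝟙 (0ℤ ℤ.≟ r)                    ≡⟨ sym (coeff-const (∑ n f) r) ⟩
      coeff (const (∑ n f)) r                ∎
      where open ≡-Reasoning

    const-zero : const 0ℤ ≈ []
    const-zero = ≈-by-coeff λ r → trans (coeff-const 0ℤ r) (ℤ.*-zeroˡ (𝟙 (0ℤ ℤ.≟ r)))

    const-++ : ∀ a b → const a ++ const b ≈ const (a + b)
    const-++ a b = ≈-by-coeff λ r → begin
      coeff (const a ++ const b) r           ≡⟨ coeff-++ (const a) (const b) r ⟩
      coeff (const a) r + coeff (const b) r  ≡⟨ cong₂ _+_ (coeff-const a r) (coeff-const b r) ⟩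
      a * 𝟙 (0ℤ ℤ.≟ r) + b * 𝟙 (0ℤ ℤ.≟ r)     ≡⟨ sym (ℤ.*-distribʳ-+ _ a b) ⟩
      (a + b) * 𝟙 (0ℤ ℤ.≟ r)                 ≡⟨ sym (coeff-const (a + b) r) ⟩
      coeff (const (a + b)) r                ∎
      where open ≡-Reasoning

    ++-const-cancel : ∀ {x y} a b → x ++ y ≈ const a → y ≈ const b → x ≈ const (a - b)
    ++-const-cancel {x} {y} a b x++y≈a y≈b = begin
      x
        ≈⟨ ≈-by-coeff (λ r → sym (trans (coeff-++ x _ r) (trans (cong (_+_ (coeff x r)) (vanishes r)) (ℤ.+-identityʳ _)))) ⟩
      x ++ const (b - b)
        ≈⟨ ++-cong (≈-refl {x}) (≈-sym (const-++ b (- b))) ⟩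
      x ++ (const b ++ const (- b))
        ≡⟨ List.++-assoc x (const b) (const (- b)) ⟨
      (x ++ const b) ++ const (- b)
        ≈⟨ ++-cong (++-cong (≈-refl {x}) (≈-sym y≈b)) (≈-refl {const (- b)}) ⟩
      (x ++ y) ++ const (- b)
        ≈⟨ ++-cong x++y≈a (≈-refl {const (- b)}) ⟩
      const a ++ const (- b)
        ≈⟨ const-++ a (- b) ⟩
      const (a - b) ∎
      where
      open ≈-Reasoning
      vanishes : ∀ r → coeff (const (b - b)) r ≡ 0ℤ
      vanishes r = trans (coeff-const (b - b) r) (trans (cong (_* 𝟙 (0ℤ ℤ.≟ r)) (ℤ.+-inverseʳ b)) (ℤ.*-zeroˡ (𝟙 (0ℤ ℤ.≟ r))))

    Σ<-block : ∀ m n (f : ℕ → Cyc) → Σ< (m ℕ.* n) f ≈ Σ< m (λ i → Σ< n (λ j → f (i ℕ.* n ℕ.+ j)))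
    Σ<-block m n f = ≈-by-coeff λ r → begin
      coeff (Σ< (m ℕ.* n) f) r                                   ≡⟨ coeff-Σ< (m ℕ.* n) f r ⟩
      ∑[ t < m ℕ.* n ] coeff (f t) r                             ≡⟨ ∑-block m n _ ⟩
      ∑[ i < m ] ∑[ j < n ] coeff (f (i ℕ.* n ℕ.+ j)) r          ≡⟨ ∑-cong m (λ i → sym (coeff-Σ< n _ r)) ⟩
      ∑[ i < m ] coeff (Σ< n (λ j → f (i ℕ.* n ℕ.+ j))) r        ≡⟨ sym (coeff-Σ< m _ r) ⟩
      coeff (Σ< m (λ i → Σ< n (λ j → f (i ℕ.* n ℕ.+ j)))) r      ∎
      where open ≡-Reasoning

    Σ<-comm : ∀ m n (f : ℕ → ℕ → Cyc) → Σ< m (λ i → Σ< n (λ j → f i j)) ≈ Σ< n (λ j → Σ< m (λ i → f i j))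
    Σ<-comm m n f = ≈-by-coeff λ r → begin
      coeff (Σ< m (λ i → Σ< n (λ j → f i j))) r    ≡⟨ coeff-Σ< m _ r ⟩
      ∑[ i < m ] coeff (Σ< n (λ j → f i j)) r      ≡⟨ ∑-cong m (λ i → coeff-Σ< n _ r) ⟩
      ∑[ i < m ] ∑[ j < n ] coeff (f i j) r        ≡⟨ ∑-comm m n _ ⟩
      ∑[ j < n ] ∑[ i < m ] coeff (f i j) r        ≡⟨ ∑-cong n (λ j → sym (coeff-Σ< m _ r)) ⟩
      ∑[ j < n ] coeff (Σ< m (λ i → f i j)) r      ≡⟨ sym (coeff-Σ< n _ r) ⟩
      coeff (Σ< n (λ j → Σ< m (λ i → f i j))) r    ∎
      where open ≡-Reasoning

    ⊙-cong : ∀ n {x y} → x ≈ y → n ⊙ x ≈ n ⊙ y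
    ⊙-cong n x≈y = Σ<-cong n λ _ → x≈y

    ⊙-const : ∀ n c → n ⊙ const c ≈ const (+ n * c)
    ⊙-const n c = ≈-trans (const-Σ< n (λ _ → c)) (≈-reflexive (cong const (∑-const n c)))

    Σ<-if-⊙ : ∀ n m (b : ℕ → Bool) (x : ℕ → Cyc) →
              Σ< n (λ t → if b t then [] else m ⊙ x t) ≈ m ⊙ Σ< n (λ t → if b t then [] else x t)
    Σ<-if-⊙ n m b x = ≈-by-coeff λ r → begin
      coeff (Σ< n (λ t → if b t then [] else m ⊙ x t)) r          ≡⟨ coeff-Σ< n _ r ⟩
      ∑[ t < n ] coeff (if b t then [] else m ⊙ x t) r            ≡⟨ ∑-cong n (λ t → pull-out (b t) (x t) r) ⟩
      ∑[ t < n ] (+ m * coeff (if b t then [] else x t) r)        ≡⟨ sym (*-distribˡ-∑ n (+ m) _) ⟩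
      + m * ∑[ t < n ] coeff (if b t then [] else x t) r          ≡⟨ cong (_*_ (+ m)) (sym (coeff-Σ< n _ r)) ⟩
      + m * coeff (Σ< n (λ t → if b t then [] else x t)) r        ≡⟨ sym (coeff-⊙ m _ r) ⟩
      coeff (m ⊙ Σ< n (λ t → if b t then [] else x t)) r          ∎
      where
      open ≡-Reasoning
      pull-out : ∀ b x r → coeff (if b then [] else m ⊙ x) r ≡ + m * coeff (if b then [] else x) r
      pull-out true  x r = sym (ℤ.*-zeroʳ (+ m))
      pull-out false x r = coeff-⊙ m x r

  [m+n]%d≡m%d⇒d∣n : ∀ m n d .{{_ : NonZero d}} → (m ℕ.+ n) % d ≡ m % d → d ∣ n
  [m+n]%d≡m%d⇒d∣n m n d eq = divides ((m ℕ.+ n) / d ℕ.∸ m / d) (begin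
    n
      ≡⟨ ℕ.m+n∸m≡n m n ⟨
    m ℕ.+ n ℕ.∸ m
      ≡⟨ cong₂ ℕ._∸_ (m≡m%n+[m/n]*n (m ℕ.+ n) d) (m≡m%n+[m/n]*n m d) ⟩
    ((m ℕ.+ n) % d ℕ.+ (m ℕ.+ n) / d ℕ.* d) ℕ.∸ (m % d ℕ.+ m / d ℕ.* d)
      ≡⟨ cong (λ z → (z ℕ.+ (m ℕ.+ n) / d ℕ.* d) ℕ.∸ (m % d ℕ.+ m / d ℕ.* d)) eq ⟩
    (m % d ℕ.+ (m ℕ.+ n) / d ℕ.* d) ℕ.∸ (m % d ℕ.+ m / d ℕ.* d)
      ≡⟨ ℕ.[m+n]∸[m+o]≡n∸o (m % d) _ _ ⟩
    (m ℕ.+ n) / d ℕ.* d ℕ.∸ m / d ℕ.* d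
      ≡⟨ ℕ.*-distribʳ-∸ d ((m ℕ.+ n) / d) (m / d) ⟨
    ((m ℕ.+ n) / d ℕ.∸ m / d) ℕ.* d ∎)
    where open ≡-Reasoning

  module _ {p : ℕ} (p-prime : Prime p) {a : ℕ} (p∤a : ¬ p ∣ a) where

    private instance
      p-nonZero : NonZero p
      p-nonZero = prime⇒nonZero p-prime

    private
      *-%-injective-≤ : ∀ {i j} → i ≤ j → j < p → (a ℕ.* i) % p ≡ (a ℕ.* j) % p → i ≡ j
      *-%-injective-≤ {i} {j} i≤j j<p eq with euclidsLemma a (j ℕ.∸ i) p-prime p∣a[j∸i]
        where
        p∣a[j∸i] : p ∣ a ℕ.* (j ℕ.∸ i)
        p∣a[j∸i] = [m+n]%d≡m%d⇒d∣n (a ℕ.* i) _ p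
          (trans (cong (_% p) (trans (sym (ℕ.*-distribˡ-+ a i _)) (cong (a ℕ.*_) (ℕ.m+[n∸m]≡n i≤j)))) (sym eq))
      ... | inj₁ p∣a   = contradiction p∣a p∤a
      ... | inj₂ p∣j∸i = ℕ.≤-antisym i≤j (ℕ.m∸n≡0⇒m≤n j∸i≡0)
        where
        j∸i≡0 : j ℕ.∸ i ≡ 0
        j∸i≡0 = trans (sym (m<n⇒m%n≡m (ℕ.≤-<-trans (ℕ.m∸n≤m j i) j<p))) (n∣m⇒m%n≡0 _ p p∣j∸i)

    *-%-injective : ∀ {i j} → i < p → j < p → (a ℕ.* i) % p ≡ (a ℕ.* j) % p → i ≡ j
    *-%-injective {i} {j} i<p j<p eq with ℕ.≤-total i j
    ... | inj₁ i≤j = *-%-injective-≤ i≤j j<p eq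
    ... | inj₂ j≤i = sym (*-%-injective-≤ j≤i i<p (sym eq))

  pos-+-* : ∀ i n t → + (i ℕ.* n ℕ.+ t) ≡ + i * + n + + t
  pos-+-* i n t = trans (ℤ.pos-+ (i ℕ.* n) t) (cong (_+ + t) (ℤ.pos-* i n))

  module CharacterSums (p k′ : ℕ) (p-prime : Prime p) where

    open Cyclotomic p k′

    private instance
      p-nonZero : NonZero p
      p-nonZero = prime⇒nonZero p-prime

    P≡D*p : + P ≡ + D * + p
    P≡D*p = trans (ℤ.pos-* p D) (ℤ.*-comm (+ p) (+ D))

    -- i ↦ (w mod p) i mod p permutes the residues mod p, which reduces the sum to the cyclotomic relation.
    character-sum-vanishes : ∀ c w → ¬ p ∣ ∣ w ∣ → Σ< p (λ i → eN (c + + D * w * + i)) ≈ []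
    character-sum-vanishes c w p∤w =
      ≈-trans (Σ<-cong p λ i → eN-≡-mod _ (reduce i)) (≈-trans (≈-by-coeff permute) (cyclotomic-relation c))
      where
      w₀ : ℕ
      w₀ = w ℤ.%ℕ p
      w-split : w ≡ + w₀ + (w ℤ./ℕ p) * + p
      w-split = ℤ.a≡a%ℕn+[a/ℕn]*n w p
      p∤w₀ : ¬ p ∣ w₀
      p∤w₀ p∣w₀ = p∤w (subst (λ v → p ∣ ∣ v ∣) (sym w≡w₁*p)
                          (subst (p ∣_) (sym (ℤ.abs-* (w ℤ./ℕ p) (+ p))) (n∣m*n ∣ w ℤ./ℕ p ∣)))
        where
        w₀≡0 : w₀ ≡ 0
        w₀≡0 = trans (sym (m<n⇒m%n≡m (ℤ.n%ℕd<d w p))) (n∣m⇒m%n≡0 w₀ p p∣w₀)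
        w≡w₁*p : w ≡ (w ℤ./ℕ p) * + p
        w≡w₁*p = trans w-split (trans (cong (λ z → + z + (w ℤ./ℕ p) * + p) w₀≡0) (ℤ.+-identityˡ _))
      σ : ℕ → ℕ
      σ i = (w₀ ℕ.* i) % p
      reduce : ∀ i → c + + D * w * + i ≡ c + + D * + σ i + + P * (+ ((w₀ ℕ.* i) / p) + (w ℤ./ℕ p) * + i)
      reduce i = begin
        c + + D * w * + i
          ≡⟨ cong (λ z → c + + D * z * + i) w-split ⟩
        c + + D * (+ w₀ + w₁ * + p) * + i
          ≡⟨ lemma₁ c (+ D) (+ w₀) w₁ (+ p) (+ i) ⟩
        c + + D * (+ w₀ * + i) + + D * + p * (w₁ * + i)
          ≡⟨ cong (λ z → c + + D * z + + D * + p * (w₁ * + i)) w₀i-split ⟩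
        c + + D * (+ σ i + + q * + p) + + D * + p * (w₁ * + i)
          ≡⟨ lemma₂ c (+ D) (+ σ i) (+ q) (+ p) (w₁ * + i) ⟩
        c + + D * + σ i + + D * + p * (+ q + w₁ * + i)
          ≡⟨ cong (λ z → c + + D * + σ i + z * (+ q + w₁ * + i)) (sym P≡D*p) ⟩
        c + + D * + σ i + + P * (+ q + w₁ * + i) ∎
        where
        open ≡-Reasoning
        w₁ : ℤ
        w₁ = w ℤ./ℕ p
        q : ℕ
        q = (w₀ ℕ.* i) / p
        w₀i-split : + w₀ * + i ≡ + σ i + + q * + p
        w₀i-split = trans (sym (ℤ.pos-* w₀ i)) (trans (cong +_ (m≡m%n+[m/n]*n (w₀ ℕ.* i) p))
                                           (trans (ℤ.pos-+ (σ i) (q ℕ.* p)) (cong (_+_ (+ σ i)) (ℤ.pos-* q p))))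
        lemma₁ : ∀ c D a b p i → c + D * (a + b * p) * i ≡ c + D * (a * i) + D * p * (b * i)
        lemma₁ = solve-∀
        lemma₂ : ∀ c D s q p x → c + D * (s + q * p) + D * p * x ≡ c + D * s + D * p * (q + x)
        lemma₂ = solve-∀
      permute : ∀ r → coeff (Σ< p (λ i → eN (c + + D * + σ i))) r ≡ coeff (Σ< p (λ i → eN (c + + D * + i))) r
      permute r = begin
        coeff (Σ< p (λ i → eN (c + + D * + σ i))) r
          ≡⟨ coeff-Σ<-eN p _ r ⟩
        ∑[ i < p ] 𝟙 (c + + D * + σ i ℤ.≟ r)
          ≡⟨ ∑-permute σ (λ _ → m%n<n _ p) (*-%-injective p-prime p∤w₀) (λ v → 𝟙 (c + + D * + v ℤ.≟ r)) ⟩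
        ∑[ i < p ] 𝟙 (c + + D * + i ℤ.≟ r)
          ≡⟨ sym (coeff-Σ<-eN p _ r) ⟩
        coeff (Σ< p (λ i → eN (c + + D * + i))) r ∎
        where open ≡-Reasoning

    pos-^-+ : ∀ m n → + (p ^ (m ℕ.+ n)) ≡ + (p ^ m) * + (p ^ n)
    pos-^-+ m n = trans (cong +_ (ℕ.^-distribˡ-+-* p m n)) (ℤ.pos-* (p ^ m) (p ^ n))

    digit-split : ∀ e J′ w t i → e ℕ.+ suc J′ ≡ k →
                  + (p ^ e) * w * + (i ℕ.* p ^ J′ ℕ.+ t) ≡ + (p ^ e) * w * + t + + D * w * + i
    digit-split e J′ w t i e+J≡k = begin
      + (p ^ e) * w * + (i ℕ.* p ^ J′ ℕ.+ t)          ≡⟨ cong (_*_ (+ (p ^ e) * w)) (pos-+-* i (p ^ J′) t) ⟩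
      + (p ^ e) * w * (+ i * + (p ^ J′) + + t)        ≡⟨ lemma (+ (p ^ e)) w (+ i) (+ (p ^ J′)) (+ t) ⟩
      + (p ^ e) * w * + t + + (p ^ e) * + (p ^ J′) * w * + i ≡⟨ cong (λ d → + (p ^ e) * w * + t + d * w * + i) (sym D≡) ⟩
      + (p ^ e) * w * + t + + D * w * + i             ∎
      where
      open ≡-Reasoning
      D≡ : + D ≡ + (p ^ e) * + (p ^ J′)
      D≡ = trans (cong (λ n → + (p ^ n)) (sym (ℕ.suc-injective (trans (sym (ℕ.+-suc e J′)) e+J≡k)))) (pos-^-+ e J′)
      lemma : ∀ a w i b t → a * w * (i * b + t) ≡ a * w * t + a * b * w * i
      lemma = solve-∀

    digit-split-multiple : ∀ e J′ q i t → e ℕ.+ suc J′ ≡ k →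
                           + (p ^ e) * (q * + p) * + (i ℕ.* p ^ J′ ℕ.+ t) ≡ + (p ^ suc e) * q * + t + + P * (q * + i)
    digit-split-multiple e J′ q i t e+J≡k = begin
      + (p ^ e) * (q * + p) * + (i ℕ.* p ^ J′ ℕ.+ t)
        ≡⟨ cong (_*_ (+ (p ^ e) * (q * + p))) (pos-+-* i (p ^ J′) t) ⟩
      + (p ^ e) * (q * + p) * (+ i * + (p ^ J′) + + t)
        ≡⟨ lemma (+ (p ^ e)) q (+ p) (+ i) (+ (p ^ J′)) (+ t) ⟩
      + p * + (p ^ e) * q * + t + + (p ^ e) * (+ p * + (p ^ J′)) * (q * + i)
        ≡⟨ cong₂ (λ a b → a * q * + t + b * (q * + i)) (sym (ℤ.pos-* p (p ^ e))) (sym P≡) ⟩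
      + (p ^ suc e) * q * + t + + P * (q * + i) ∎
      where
      open ≡-Reasoning
      P≡ : + P ≡ + (p ^ e) * (+ p * + (p ^ J′))
      P≡ = trans (cong (λ n → + (p ^ n)) (sym e+J≡k)) (trans (pos-^-+ e (suc J′)) (cong (_*_ (+ (p ^ e))) (ℤ.pos-* p (p ^ J′))))
      lemma : ∀ a q p i b t → a * (q * p) * (i * b + t) ≡ p * a * q * t + a * (p * b) * (q * i)
      lemma = solve-∀

    completeSum : ℕ → ℕ → ℤ → Cyc
    completeSum e J w = Σ< (p ^ J) (λ t → eN (+ (p ^ e) * w * + t))

    completeSumValue : ℕ → ℤ → ℤ
    completeSumValue J w = + (p ^ J) * 𝟙 ((p ^ J) ∣? ∣ w ∣)

    completeSum≈ : ∀ J e w → e ℕ.+ J ≡ k → completeSum e J w ≈ const (completeSumValue J w)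
    completeSum≈ zero e w _ = ≈-reflexive (cong₂ (λ c s → (c , s) ∷ [])
      (sym (trans (ℤ.*-identityˡ _) (𝟙-yes (1 ∣? ∣ w ∣) (1∣ _)))) (ℤ.*-zeroʳ (+ (p ^ e) * w)))
    completeSum≈ (suc J′) e w e+J≡k with p ∣? ∣ w ∣
    ... | yes p∣w = begin
      completeSum e (suc J′) w
        ≈⟨ Σ<-block p (p ^ J′) _ ⟩
      Σ< p (λ i → Σ< (p ^ J′) (λ t → eN (+ (p ^ e) * w * + (i ℕ.* p ^ J′ ℕ.+ t))))
        ≈⟨ Σ<-cong p (λ i → Σ<-cong (p ^ J′) λ t → eN-≡-mod (q * + i) (reduce i t)) ⟩
      Σ< p (λ i → completeSum (suc e) J′ q)
        ≈⟨ Σ<-cong p (λ i → completeSum≈ J′ (suc e) q (trans (sym (ℕ.+-suc e J′)) e+J≡k)) ⟩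
      Σ< p (λ i → const (completeSumValue J′ q))
        ≈⟨ const-Σ< p _ ⟩
      const (∑[ i < p ] completeSumValue J′ q)
        ≡⟨ cong const (trans (∑-const p _) value) ⟩
      const (completeSumValue (suc J′) w) ∎
      where
      open ≈-Reasoning
      q : ℤ
      q = ℤ.quotient (ℤ.∣ᵤ⇒∣ {+ p} {w} p∣w)
      w≡q*p : w ≡ q * + p
      w≡q*p = ℤ._∣_.equality (ℤ.∣ᵤ⇒∣ {+ p} {w} p∣w)
      reduce : ∀ i t → + (p ^ e) * w * + (i ℕ.* p ^ J′ ℕ.+ t) ≡ + (p ^ suc e) * q * + t + + P * (q * + i)
      reduce i t = trans (cong (λ v → + (p ^ e) * v * + (i ℕ.* p ^ J′ ℕ.+ t)) w≡q*p) (digit-split-multiple e J′ q i t e+J≡k)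
      ∣w∣≡∣q∣*p : ∣ w ∣ ≡ ∣ q ∣ ℕ.* p
      ∣w∣≡∣q∣*p = trans (cong ∣_∣ w≡q*p) (ℤ.abs-* q (+ p))
      divides⇔ : ((p ^ J′) ∣ ∣ q ∣) ⇔ ((p ^ suc J′) ∣ ∣ w ∣)
      divides⇔ = mk⇔ (λ d → subst₂ _∣_ (ℕ.*-comm (p ^ J′) p) (sym ∣w∣≡∣q∣*p) (*-monoˡ-∣ p d))
                     (λ d → *-cancelʳ-∣ p (subst₂ _∣_ (ℕ.*-comm p (p ^ J′)) ∣w∣≡∣q∣*p d))
      value : + p * completeSumValue J′ q ≡ completeSumValue (suc J′) w
      value = trans (sym (ℤ.*-assoc (+ p) (+ (p ^ J′)) _))
                    (cong₂ _*_ (sym (ℤ.pos-* p (p ^ J′))) (𝟙-cong ((p ^ J′) ∣? ∣ q ∣) ((p ^ suc J′) ∣? ∣ w ∣) divides⇔))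
    ... | no p∤w = begin
      completeSum e (suc J′) w
        ≈⟨ Σ<-block p (p ^ J′) _ ⟩
      Σ< p (λ i → Σ< (p ^ J′) (λ t → eN (+ (p ^ e) * w * + (i ℕ.* p ^ J′ ℕ.+ t))))
        ≈⟨ Σ<-comm p (p ^ J′) _ ⟩
      Σ< (p ^ J′) (λ t → Σ< p (λ i → eN (+ (p ^ e) * w * + (i ℕ.* p ^ J′ ℕ.+ t))))
        ≈⟨ Σ<-cong (p ^ J′) (λ t → Σ<-cong p λ i → ≈-reflexive (cong eN (digit-split e J′ w t i e+J≡k))) ⟩
      Σ< (p ^ J′) (λ t → Σ< p (λ i → eN (+ (p ^ e) * w * + t + + D * w * + i)))
        ≈⟨ Σ<-cong (p ^ J′) (λ t → character-sum-vanishes (+ (p ^ e) * w * + t) w p∤w) ⟩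
      Σ< (p ^ J′) (λ _ → [])
        ≈⟨ ≈-by-coeff (λ r → trans (coeff-Σ< (p ^ J′) _ r) (∑-zero (p ^ J′))) ⟩
      []
        ≈⟨ ≈-sym const-zero ⟩
      const 0ℤ
        ≡⟨ cong const value≡0 ⟨
      const (completeSumValue (suc J′) w) ∎
      where
      open ≈-Reasoning
      value≡0 : completeSumValue (suc J′) w ≡ 0ℤ
      value≡0 = trans (cong (_*_ (+ (p ^ suc J′))) (𝟙-no (_ ∣? _) (p∤w ∘ ∣-trans (m∣m*n (p ^ J′))))) (ℤ.*-zeroʳ (+ (p ^ suc J′)))

    ramanujanSum : ℕ → ℕ → ℤ → Cyc
    ramanujanSum e J w = Σ< (p ^ J) (λ t → if ⌊ p ∣? t ⌋ then [] else eN (+ (p ^ e) * w * + t))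

    completeSum-split : ∀ e J′ w → completeSum e (suc J′) w ≈ ramanujanSum e (suc J′) w ++ completeSum (suc e) J′ w
    completeSum-split e J′ w = ≈-by-coeff λ r → begin
      coeff (completeSum e (suc J′) w) r
        ≡⟨ trans (coeff-Σ<-eN (p ^ suc J′) _ r) (∑-cong (p ^ suc J′) λ t → if-split ⌊ p ∣? t ⌋ (g r t)) ⟩
      ∑[ t < p ^ suc J′ ] ((if ⌊ p ∣? t ⌋ then 0ℤ else g r t) + (if ⌊ p ∣? t ⌋ then g r t else 0ℤ))
        ≡⟨ ∑-distrib-+ (p ^ suc J′) _ _ ⟩
      ∑[ t < p ^ suc J′ ] (if ⌊ p ∣? t ⌋ then 0ℤ else g r t) + ∑[ t < p ^ suc J′ ] (if ⌊ p ∣? t ⌋ then g r t else 0ℤ)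
        ≡⟨ cong₂ _+_ (sym (units r)) (multiples r) ⟩
      coeff (ramanujanSum e (suc J′) w) r + coeff (completeSum (suc e) J′ w) r
        ≡⟨ sym (coeff-++ (ramanujanSum e (suc J′) w) _ r) ⟩
      coeff (ramanujanSum e (suc J′) w ++ completeSum (suc e) J′ w) r ∎
      where
      open ≡-Reasoning
      g : ℤ → ℕ → ℤ
      g r t = 𝟙 (+ (p ^ e) * w * + t ℤ.≟ r)
      if-split : ∀ (b : Bool) x → x ≡ (if b then 0ℤ else x) + (if b then x else 0ℤ)
      if-split true  x = sym (ℤ.+-identityˡ x)
      if-split false x = sym (ℤ.+-identityʳ x)
      units : ∀ r → coeff (ramanujanSum e (suc J′) w) r ≡ ∑[ t < p ^ suc J′ ] (if ⌊ p ∣? t ⌋ then 0ℤ else g r t)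
      units r = coeff-Σ<-if-eN (p ^ suc J′) (λ t → ⌊ p ∣? t ⌋) _ r
      multiples : ∀ r → ∑[ t < p ^ suc J′ ] (if ⌊ p ∣? t ⌋ then g r t else 0ℤ) ≡ coeff (completeSum (suc e) J′ w) r
      multiples r = begin
        ∑[ t < p ^ suc J′ ] (if ⌊ p ∣? t ⌋ then g r t else 0ℤ)
          ≡⟨ cong (λ n → ∑[ t < n ] (if ⌊ p ∣? t ⌋ then g r t else 0ℤ)) (ℕ.*-comm p (p ^ J′)) ⟩
        ∑[ t < p ^ J′ ℕ.* p ] (if ⌊ p ∣? t ⌋ then g r t else 0ℤ)
          ≡⟨ ∑-multiples (p ^ J′) p (g r) ⟩
        ∑[ i < p ^ J′ ] g r (i ℕ.* p)
          ≡⟨ ∑-cong (p ^ J′) (λ i → cong (λ z → 𝟙 (z ℤ.≟ r)) (scale i)) ⟩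
        ∑[ i < p ^ J′ ] 𝟙 (+ (p ^ suc e) * w * + i ℤ.≟ r)
          ≡⟨ sym (coeff-Σ<-eN (p ^ J′) _ r) ⟩
        coeff (completeSum (suc e) J′ w) r ∎
        where
        scale : ∀ i → + (p ^ e) * w * + (i ℕ.* p) ≡ + (p ^ suc e) * w * + i
        scale i = trans (cong (_*_ (+ (p ^ e) * w)) (ℤ.pos-* i p))
                        (trans (lemma (+ (p ^ e)) w (+ i) (+ p)) (cong (λ a → a * w * + i) (sym (ℤ.pos-* p (p ^ e)))))
          where
          lemma : ∀ a w i p → a * w * (i * p) ≡ p * a * w * i
          lemma = solve-∀

    ramanujanSum≈ : ∀ e J′ w → e ℕ.+ suc J′ ≡ k →
                    ramanujanSum e (suc J′) w ≈ const (completeSumValue (suc J′) w - completeSumValue J′ w)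
    ramanujanSum≈ e J′ w e+J≡k = ++-const-cancel _ _
      (≈-trans (≈-sym (completeSum-split e J′ w)) (completeSum≈ (suc J′) e w e+J≡k))
      (completeSum≈ J′ (suc e) w (trans (sym (ℕ.+-suc e J′)) e+J≡k))

    Σ<-units-G≈Σ<-ramanujanSum : ∀ τ J A → Σ< (p ^ J) (λ t → if ⌊ p ∣? t ⌋ then [] else G p k (A * + t * + (p ^ τ)))
                            ≈ Σ< P (λ j → ramanujanSum τ J (A * + (j ℕ.* j)))
    Σ<-units-G≈Σ<-ramanujanSum τ J A = ≈-by-coeff λ r → begin
      coeff (Σ< (p ^ J) (λ t → if ⌊ p ∣? t ⌋ then [] else G p k (X t))) r
        ≡⟨ trans (coeff-Σ< (p ^ J) _ r) (∑-cong (p ^ J) λ t →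
             trans (coeff-if ⌊ p ∣? t ⌋ _ r) (cong (λ z → if ⌊ p ∣? t ⌋ then 0ℤ else z) (coeff-Σ<-eN P _ r))) ⟩
      ∑[ t < p ^ J ] (if ⌊ p ∣? t ⌋ then 0ℤ else ∑[ j < P ] 𝟙 (X t * + (j ℕ.* j) ℤ.≟ r))
        ≡⟨ ∑-cong (p ^ J) (λ t → if-∑ ⌊ p ∣? t ⌋ P _) ⟩
      ∑[ t < p ^ J ] ∑[ j < P ] (if ⌊ p ∣? t ⌋ then 0ℤ else 𝟙 (X t * + (j ℕ.* j) ℤ.≟ r))
        ≡⟨ ∑-comm (p ^ J) P _ ⟩
      ∑[ j < P ] ∑[ t < p ^ J ] (if ⌊ p ∣? t ⌋ then 0ℤ else 𝟙 (X t * + (j ℕ.* j) ℤ.≟ r))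
        ≡⟨ ∑-cong P (λ j → ∑-cong (p ^ J) λ t →
             cong (λ z → if ⌊ p ∣? t ⌋ then 0ℤ else 𝟙 (z ℤ.≟ r)) (lemma A (+ t) (+ (p ^ τ)) (+ (j ℕ.* j)))) ⟩
      ∑[ j < P ] ∑[ t < p ^ J ] (if ⌊ p ∣? t ⌋ then 0ℤ else 𝟙 (+ (p ^ τ) * (A * + (j ℕ.* j)) * + t ℤ.≟ r))
        ≡⟨ sym (trans (coeff-Σ< P _ r) (∑-cong P λ j → coeff-Σ<-if-eN (p ^ J) (λ t → ⌊ p ∣? t ⌋) _ r)) ⟩
      coeff (Σ< P (λ j → ramanujanSum τ J (A * + (j ℕ.* j)))) r ∎
      where
      open ≡-Reasoning
      X : ℕ → ℤ
      X t = A * + t * + (p ^ τ)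
      lemma : ∀ a t q u → a * t * q * u ≡ q * (a * u) * t
      lemma = solve-∀

  module _ {p : ℕ} (p-prime : Prime p) {A : ℕ} (p∤A : ¬ p ∣ A) where

    private instance
      p-nonZero : NonZero p
      p-nonZero = prime⇒nonZero p-prime

    p∣A*j*j⇒p∣j : ∀ {j} → p ∣ A ℕ.* (j ℕ.* j) → p ∣ j
    p∣A*j*j⇒p∣j {j} p∣ with euclidsLemma A (j ℕ.* j) p-prime p∣
    ... | inj₁ p∣A = contradiction p∣A p∤A
    ... | inj₂ p∣j*j with euclidsLemma j j p-prime p∣j*j
    ...   | inj₁ p∣j = p∣j
    ...   | inj₂ p∣j = p∣j

    private
      square-lemma : ∀ A j p → A ℕ.* (j ℕ.* p ℕ.* (j ℕ.* p)) ≡ p ℕ.* (p ℕ.* (A ℕ.* (j ℕ.* j)))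
      square-lemma = ℕ-Solver.solve-∀

      p^e∣A*j*j⇒p^⌈e/2⌉∣j : ∀ e j → p ^ e ∣ A ℕ.* (j ℕ.* j) → p ^ ⌈ e /2⌉ ∣ j
      p^e∣A*j*j⇒p^⌈e/2⌉∣j zero          j _ = 1∣ j
      p^e∣A*j*j⇒p^⌈e/2⌉∣j (suc zero)    j p∣ =
        subst (_∣ j) (sym (ℕ.*-identityʳ p)) (p∣A*j*j⇒p∣j (subst (_∣ A ℕ.* (j ℕ.* j)) (ℕ.*-identityʳ p) p∣))
      p^e∣A*j*j⇒p^⌈e/2⌉∣j (suc (suc e)) j p^e+2∣ with p∣A*j*j⇒p∣j {j} (∣-trans (∣m⇒∣m*n (p ^ suc e) (∣-refl {p})) p^e+2∣)
      ... | divides-refl j′ = subst (_∣ j′ ℕ.* p) (ℕ.*-comm (p ^ ⌈ e /2⌉) p)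
                                (*-monoˡ-∣ p (p^e∣A*j*j⇒p^⌈e/2⌉∣j e j′ (*-cancelˡ-∣ p (*-cancelˡ-∣ p p^e+2∣′))))
        where
        p^e+2∣′ : p ℕ.* (p ℕ.* p ^ e) ∣ p ℕ.* (p ℕ.* (A ℕ.* (j′ ℕ.* j′)))
        p^e+2∣′ = subst (p ℕ.* (p ℕ.* p ^ e) ∣_) (square-lemma A j′ p) p^e+2∣

      p^⌈e/2⌉∣j⇒p^e∣A*j*j : ∀ e j → p ^ ⌈ e /2⌉ ∣ j → p ^ e ∣ A ℕ.* (j ℕ.* j)
      p^⌈e/2⌉∣j⇒p^e∣A*j*j zero          j _ = 1∣ _
      p^⌈e/2⌉∣j⇒p^e∣A*j*j (suc zero)    j p∣j = ∣n⇒∣m*n A (∣m⇒∣m*n j p∣j)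
      p^⌈e/2⌉∣j⇒p^e∣A*j*j (suc (suc e)) j (divides-refl q) = subst (p ℕ.* (p ℕ.* p ^ e) ∣_) (lemma A q p (p ^ ⌈ e /2⌉))
        (*-monoʳ-∣ p (*-monoʳ-∣ p (p^⌈e/2⌉∣j⇒p^e∣A*j*j e (q ℕ.* p ^ ⌈ e /2⌉) (n∣m*n q))))
        where
        lemma : ∀ A q p h → p ℕ.* (p ℕ.* (A ℕ.* (q ℕ.* h ℕ.* (q ℕ.* h)))) ≡ A ℕ.* (q ℕ.* (p ℕ.* h) ℕ.* (q ℕ.* (p ℕ.* h)))
        lemma = ℕ-Solver.solve-∀

    p^e∣A*j*j⇔p^⌈e/2⌉∣j : ∀ e j → (p ^ e ∣ A ℕ.* (j ℕ.* j)) ⇔ (p ^ ⌈ e /2⌉ ∣ j)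
    p^e∣A*j*j⇔p^⌈e/2⌉∣j e j = mk⇔ (p^e∣A*j*j⇒p^⌈e/2⌉∣j e j) (p^⌈e/2⌉∣j⇒p^e∣A*j*j e j)

    count-p^e∣A*j*j : ∀ k e → ⌈ e /2⌉ ≤ k → ∑[ j < p ^ k ] 𝟙 (p ^ e ∣? A ℕ.* (j ℕ.* j)) ≡ + (p ^ (k ∸ ⌈ e /2⌉))
    count-p^e∣A*j*j k e ⌈e/2⌉≤k = begin
      ∑[ j < p ^ k ] 𝟙 (p ^ e ∣? A ℕ.* (j ℕ.* j))
        ≡⟨ ∑-cong (p ^ k) (λ j → 𝟙-cong (_ ∣? _) (_ ∣? j) (p^e∣A*j*j⇔p^⌈e/2⌉∣j e j)) ⟩
      ∑[ j < p ^ k ] 𝟙 (p ^ h ∣? j)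
        ≡⟨ cong (λ n → ∑[ j < n ] 𝟙 (p ^ h ∣? j)) p^k≡ ⟩
      ∑[ j < p ^ (k ∸ h) ℕ.* p ^ h ] 𝟙 (p ^ h ∣? j)
        ≡⟨ ∑-multiples (p ^ (k ∸ h)) (p ^ h) (λ _ → 1ℤ) ⟩
      ∑[ i < p ^ (k ∸ h) ] 1ℤ
        ≡⟨ trans (∑-const (p ^ (k ∸ h)) 1ℤ) (ℤ.*-identityʳ _) ⟩
      + (p ^ (k ∸ h)) ∎
      where
      open ≡-Reasoning
      h : ℕ
      h = ⌈ e /2⌉
      instance
        p^h-nonZero : NonZero (p ^ h)
        p^h-nonZero = ℕ.m^n≢0 p h
      p^k≡ : p ^ k ≡ p ^ (k ∸ h) ℕ.* p ^ h
      p^k≡ = trans (cong (p ^_) (sym (ℕ.m∸n+n≡m ⌈e/2⌉≤k))) (ℕ.^-distribˡ-+-* p (k ∸ h) h)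

  even⊎odd : ∀ n → (∃[ h ] n ≡ h ℕ.+ h) ⊎ (∃[ h ] n ≡ suc (h ℕ.+ h))
  even⊎odd zero    = inj₁ (0 , refl)
  even⊎odd (suc n) with even⊎odd n
  ... | inj₁ (h , n≡h+h)   = inj₂ (h , cong suc n≡h+h)
  ... | inj₂ (h , n≡1+h+h) = inj₁ (suc h , trans (cong suc n≡1+h+h) (cong suc (sym (ℕ.+-suc h h))))

  2∣2+h+h : ∀ h → 2 ∣ suc (suc (h ℕ.+ h))
  2∣2+h+h h = divides (suc h) (lemma h)
    where
    lemma : ∀ h → suc (suc (h ℕ.+ h)) ≡ suc h ℕ.* 2
    lemma = ℕ-Solver.solve-∀

  2∤1+h+h : ∀ h → ¬ 2 ∣ suc (h ℕ.+ h)
  2∤1+h+h h 2∣ = ℕ.<-irrefl refl (∣⇒≤ (∣m+n∣m⇒∣n (subst (2 ∣_) (ℕ.+-comm 1 (h ℕ.+ h)) 2∣) (divides h (lemma h))))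
    where
    lemma : ∀ h → h ℕ.+ h ≡ h ℕ.* 2
    lemma = ℕ-Solver.solve-∀

  evenTerm : ℕ → ℕ → ℕ → ℤ
  evenTerm p k n = if ⌊ 2 ∣? n ⌋ then + (p ^ (3 ℕ.* k ℕ.+ ⌊ n /2⌋ ∸ 1)) * (+ p - 1ℤ) else 0ℤ

  module _ (p k : ℕ) where

    private
      g : ℕ → ℤ
      g x = + (p ^ (3 ℕ.* k ℕ.+ x))

      g-suc : ∀ x → g (suc x) ≡ + p * g x
      g-suc x = trans (cong (λ n → + (p ^ n)) (ℕ.+-suc (3 ℕ.* k) x)) (ℤ.pos-* p _)

    evenTerm-telescopes : ∀ n → evenTerm p k (suc n) ≡ + (p ^ (3 ℕ.* k ℕ.+ ⌊ suc n /2⌋)) - + (p ^ (3 ℕ.* k ℕ.+ ⌊ n /2⌋))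
    evenTerm-telescopes n with even⊎odd n
    ... | inj₁ (h , refl) = begin
      evenTerm p k (suc (h ℕ.+ h))
        ≡⟨ cong (if_then + (p ^ (3 ℕ.* k ℕ.+ ⌊ suc (h ℕ.+ h) /2⌋ ∸ 1)) * (+ p - 1ℤ) else 0ℤ) (⌊⌋-false (2 ∣? _) (2∤1+h+h h)) ⟩
      0ℤ
        ≡⟨ sym (ℤ.+-inverseʳ (g h)) ⟩
      g h - g h
        ≡⟨ cong₂ (λ a b → g a - g b) (ℕ.n≡⌈n+n/2⌉ h) (ℕ.n≡⌊n+n/2⌋ h) ⟩
      g ⌊ suc (h ℕ.+ h) /2⌋ - g ⌊ h ℕ.+ h /2⌋ ∎
      where open ≡-Reasoning
    ... | inj₂ (h , refl) = begin
      evenTerm p k (suc (suc (h ℕ.+ h)))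
        ≡⟨ cong (if_then + (p ^ (3 ℕ.* k ℕ.+ suc ⌊ h ℕ.+ h /2⌋ ∸ 1)) * (+ p - 1ℤ) else 0ℤ) (⌊⌋-true (2 ∣? _) (2∣2+h+h h)) ⟩
      + (p ^ (3 ℕ.* k ℕ.+ suc ⌊ h ℕ.+ h /2⌋ ∸ 1)) * (+ p - 1ℤ)
        ≡⟨ cong (λ x → + (p ^ (3 ℕ.* k ℕ.+ suc x ∸ 1)) * (+ p - 1ℤ)) (sym (ℕ.n≡⌊n+n/2⌋ h)) ⟩
      + (p ^ (3 ℕ.* k ℕ.+ suc h ∸ 1)) * (+ p - 1ℤ)
        ≡⟨ cong (λ x → + (p ^ (x ∸ 1)) * (+ p - 1ℤ)) (ℕ.+-suc (3 ℕ.* k) h) ⟩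
      g h * (+ p - 1ℤ)
        ≡⟨ lemma (g h) (+ p) ⟩
      + p * g h - g h
        ≡⟨ cong₂ (λ a b → a - g b) (sym (g-suc h)) (ℕ.n≡⌈n+n/2⌉ h) ⟩
      g (suc h) - g ⌊ suc (h ℕ.+ h) /2⌋
        ≡⟨ cong (λ x → g (suc x) - g ⌊ suc (h ℕ.+ h) /2⌋) (ℕ.n≡⌊n+n/2⌋ h) ⟩
      g ⌊ suc (suc (h ℕ.+ h)) /2⌋ - g ⌊ suc (h ℕ.+ h) /2⌋ ∎
      where
      open ≡-Reasoning
      lemma : ∀ a p → a * (p - 1ℤ) ≡ p * a - a
      lemma = solve-∀

    ∑-evenTerm : ∀ n → ∑[ τ < n ] evenTerm p k (n ∸ τ) ≡ + (p ^ (3 ℕ.* k)) * (+ (p ^ ⌊ n /2⌋) - 1ℤ)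
    ∑-evenTerm zero    = sym (ℤ.*-zeroʳ (+ (p ^ (3 ℕ.* k))))
    ∑-evenTerm (suc n) = begin
      evenTerm p k (suc n) + ∑[ τ < n ] evenTerm p k (n ∸ τ)
        ≡⟨ cong₂ _+_ (evenTerm-telescopes n) (∑-evenTerm n) ⟩
      g ⌊ suc n /2⌋ - g ⌊ n /2⌋ + + (p ^ (3 ℕ.* k)) * (+ (p ^ ⌊ n /2⌋) - 1ℤ)
        ≡⟨ cong₂ (λ a b → a - b + + (p ^ (3 ℕ.* k)) * (+ (p ^ ⌊ n /2⌋) - 1ℤ)) (g≡ ⌊ suc n /2⌋) (g≡ ⌊ n /2⌋) ⟩
      + (p ^ (3 ℕ.* k)) * + (p ^ ⌊ suc n /2⌋) - + (p ^ (3 ℕ.* k)) * + (p ^ ⌊ n /2⌋) + + (p ^ (3 ℕ.* k)) * (+ (p ^ ⌊ n /2⌋) - 1ℤ)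
        ≡⟨ lemma (+ (p ^ (3 ℕ.* k))) _ _ ⟩
      + (p ^ (3 ℕ.* k)) * (+ (p ^ ⌊ suc n /2⌋) - 1ℤ) ∎
      where
      open ≡-Reasoning
      g≡ : ∀ x → g x ≡ + (p ^ (3 ℕ.* k)) * + (p ^ x)
      g≡ x = trans (cong +_ (ℕ.^-distribˡ-+-* p (3 ℕ.* k) x)) (ℤ.pos-* (p ^ (3 ℕ.* k)) (p ^ x))
      lemma : ∀ c a b → c * a - c * b + c * (b - 1ℤ) ≡ c * (a - 1ℤ)
      lemma = solve-∀

  ∑-final-segment : ∀ (f : ℕ → ℤ) n m → n ≤ m →
                    ∑[ τ < m ] (if (m ∸ n) ≤ᵇ τ then f (m ∸ τ) else 0ℤ) ≡ ∑[ τ < n ] f (n ∸ τ)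
  ∑-final-segment f n zero    z≤n = refl
  ∑-final-segment f n (suc m) n≤1+m with n ℕ.≟ suc m
  ... | yes refl = ∑-cong n λ τ → cong (λ z → if z ≤ᵇ τ then f (n ∸ τ) else 0ℤ) (ℕ.n∸n≡0 n)
  ... | no n≢1+m = begin
    (if (suc m ∸ n) ≤ᵇ 0 then f (suc m) else 0ℤ) + ∑[ τ < m ] (if (suc m ∸ n) ≤ᵇ suc τ then f (m ∸ τ) else 0ℤ)
      ≡⟨ cong₂ _+_ (cong (λ z → if z ≤ᵇ 0 then f (suc m) else 0ℤ) 1+m∸n≡)
                   (∑-cong m λ τ → cong (λ z → if z then f (m ∸ τ) else 0ℤ) (trans (cong (_≤ᵇ suc τ) 1+m∸n≡) (≤ᵇ-suc (m ∸ n) τ))) ⟩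
    0ℤ + ∑[ τ < m ] (if (m ∸ n) ≤ᵇ τ then f (m ∸ τ) else 0ℤ)
      ≡⟨ trans (ℤ.+-identityˡ _) (∑-final-segment f n m n≤m) ⟩
    ∑[ τ < n ] f (n ∸ τ) ∎
    where
    open ≡-Reasoning
    n≤m : n ≤ m
    n≤m = ℕ.≤-pred (ℕ.≤∧≢⇒< n≤1+m n≢1+m)
    1+m∸n≡ : suc m ∸ n ≡ suc (m ∸ n)
    1+m∸n≡ = ℕ.+-∸-assoc 1 n≤m
    ≤ᵇ-suc : ∀ a b → (suc a ≤ᵇ suc b) ≡ (a ≤ᵇ b)
    ≤ᵇ-suc zero    b = refl
    ≤ᵇ-suc (suc a) b = refl

  midSum-as-∑ : ∀ p n₁ k → midSum p n₁ k ≡ ∑[ τ < k ] (if (k ∸ n₁) ≤ᵇ τ then evenTerm p k (k ∸ τ) else 0ℤ)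
  midSum-as-∑ p n₁ k = trans (sumℤ-upTo k _) (∑-cong k λ τ → if-∧ ((k ∸ n₁) ≤ᵇ τ) _ _)
    where
    if-∧ : ∀ b c (x : ℤ) → (if b ∧ c then x else 0ℤ) ≡ (if b then (if c then x else 0ℤ) else 0ℤ)
    if-∧ true  c x = refl
    if-∧ false c x = refl

  midSum-closed-form : ∀ p n₁ k → n₁ ≤ k → midSum p n₁ k ≡ + (p ^ (3 ℕ.* k)) * (+ (p ^ ⌊ n₁ /2⌋) - 1ℤ)
  midSum-closed-form p n₁ k n₁≤k = begin
    midSum p n₁ k                                                    ≡⟨ midSum-as-∑ p n₁ k ⟩
    ∑[ τ < k ] (if (k ∸ n₁) ≤ᵇ τ then evenTerm p k (k ∸ τ) else 0ℤ)  ≡⟨ ∑-final-segment (evenTerm p k) n₁ k n₁≤k ⟩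
    ∑[ τ < n₁ ] evenTerm p k (n₁ ∸ τ)                                ≡⟨ ∑-evenTerm p k n₁ ⟩
    + (p ^ (3 ℕ.* k)) * (+ (p ^ ⌊ n₁ /2⌋) - 1ℤ)                      ∎
    where open ≡-Reasoning

  module GaussSums (p k′ : ℕ) where

    open Cyclotomic p k′

    private
      sq : ℕ → ℤ
      sq j = + (j ℕ.* j)

    coeff-gauss-product : ∀ X₀ X₁ X₂ X₃ r →
      coeff (eN X₀ ⊗ (G p k X₁ ⊗ (G p k X₂ ⊗ G p k X₃))) r ≡
      ∑[ j₁ < P ] ∑[ j₂ < P ] ∑[ j₃ < P ] 𝟙 (X₀ + (X₁ * sq j₁ + (X₂ * sq j₂ + X₃ * sq j₃)) ℤ.≟ r)
    coeff-gauss-product X₀ X₁ X₂ X₃ r = begin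
      coeff (eN X₀ ⊗ (G p k X₁ ⊗ (G p k X₂ ⊗ G p k X₃))) r
        ≡⟨ coeff-eN-⊗ X₀ (G p k X₁ ⊗ (G p k X₂ ⊗ G p k X₃)) r ⟩
      coeff (G p k X₁ ⊗ (G p k X₂ ⊗ G p k X₃)) (r - X₀)
        ≡⟨ coeff-Σ<eN-⊗ P (λ j → X₁ * sq j) (G p k X₂ ⊗ G p k X₃) (r - X₀) ⟩
      ∑[ j₁ < P ] coeff (G p k X₂ ⊗ G p k X₃) (r - X₀ - X₁ * sq j₁)
        ≡⟨ ∑-cong P (λ j₁ → coeff-Σ<eN-⊗ P (λ j → X₂ * sq j) (G p k X₃) _) ⟩
      ∑[ j₁ < P ] ∑[ j₂ < P ] coeff (G p k X₃) (r - X₀ - X₁ * sq j₁ - X₂ * sq j₂)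
        ≡⟨ ∑-cong P (λ j₁ → ∑-cong P λ j₂ → trans (coeff-Σ<-eN P (λ j → X₃ * sq j) _) (∑-cong P λ j₃ → shifts j₁ j₂ j₃)) ⟩
      ∑[ j₁ < P ] ∑[ j₂ < P ] ∑[ j₃ < P ] 𝟙 (X₀ + (X₁ * sq j₁ + (X₂ * sq j₂ + X₃ * sq j₃)) ℤ.≟ r) ∎
      where
      open ≡-Reasoning
      shifts : ∀ j₁ j₂ j₃ → 𝟙 (X₃ * sq j₃ ℤ.≟ r - X₀ - X₁ * sq j₁ - X₂ * sq j₂)
                            ≡ 𝟙 (X₀ + (X₁ * sq j₁ + (X₂ * sq j₂ + X₃ * sq j₃)) ℤ.≟ r)
      shifts j₁ j₂ j₃ = trans (𝟙-shift _ (X₂ * sq j₂) _) (trans (𝟙-shift _ (X₁ * sq j₁) _) (𝟙-shift _ X₀ r))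

    gauss-product-collapse : ∀ {X₀ X₂ X₃} X y₀ y₂ y₃ → X₀ ≡ + P * y₀ → X₂ ≡ + P * y₂ → X₃ ≡ + P * y₃ →
                             eN X₀ ⊗ (G p k X ⊗ (G p k X₂ ⊗ G p k X₃)) ≈ P ⊙ P ⊙ G p k X
    gauss-product-collapse X y₀ y₂ y₃ refl refl refl = begin
      eN (+ P * y₀) ⊗ (G p k X ⊗ (G p k (+ P * y₂) ⊗ G p k (+ P * y₃)))
        ≈⟨ ≈-by-coeff expand ⟩
      Σ< P (λ j₂ → Σ< P (λ j₃ → Σ< P (λ j₁ → eN (E j₁ j₂ j₃))))
        ≈⟨ Σ<-cong P (λ j₂ → Σ<-cong P λ j₃ → Σ<-cong P λ j₁ → eN-≡-mod _ (reduce j₁ j₂ j₃)) ⟩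
      P ⊙ P ⊙ G p k X ∎
      where
      open ≈-Reasoning
      E : ℕ → ℕ → ℕ → ℤ
      E j₁ j₂ j₃ = + P * y₀ + (X * sq j₁ + (+ P * y₂ * sq j₂ + + P * y₃ * sq j₃))
      reduce : ∀ j₁ j₂ j₃ → E j₁ j₂ j₃ ≡ X * sq j₁ + + P * (y₀ + (y₂ * sq j₂ + y₃ * sq j₃))
      reduce j₁ j₂ j₃ = lemma (+ P) y₀ X (sq j₁) y₂ (sq j₂) y₃ (sq j₃)
        where
        lemma : ∀ P y₀ X u₁ y₂ u₂ y₃ u₃ →
                P * y₀ + (X * u₁ + (P * y₂ * u₂ + P * y₃ * u₃)) ≡ X * u₁ + P * (y₀ + (y₂ * u₂ + y₃ * u₃))
        lemma = solve-∀
      expand : ∀ r → coeff (eN (+ P * y₀) ⊗ (G p k X ⊗ (G p k (+ P * y₂) ⊗ G p k (+ P * y₃)))) r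
                     ≡ coeff (Σ< P (λ j₂ → Σ< P (λ j₃ → Σ< P (λ j₁ → eN (E j₁ j₂ j₃))))) r
      expand r = trans (coeff-gauss-product (+ P * y₀) X (+ P * y₂) (+ P * y₃) r)
        (trans (∑-comm P P _) (trans (∑-cong P λ j₂ → ∑-comm P P _)
        (sym (trans (coeff-Σ< P _ r) (∑-cong P λ j₂ → trans (coeff-Σ< P _ r) (∑-cong P λ j₃ → coeff-Σ<-eN P _ r))))))

  module Evaluation (p k′ : ℕ) (p-prime : Prime p) {a : ℤ} (p∤a : ¬ p ∣ ∣ a ∣) where

    open Cyclotomic p k′
    open CharacterSums p k′ p-prime
    open GaussSums p k′

    ∑-completeSumValue-squares : ∀ e → ⌈ e /2⌉ ≤ k → ∑[ j < P ] completeSumValue e (a * + (j ℕ.* j)) ≡ + (p ^ (k ℕ.+ ⌊ e /2⌋))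
    ∑-completeSumValue-squares e ⌈e/2⌉≤k = begin
      ∑[ j < P ] (+ (p ^ e) * 𝟙 (p ^ e ∣? ∣ a * + (j ℕ.* j) ∣))
        ≡⟨ sym (*-distribˡ-∑ P (+ (p ^ e)) _) ⟩
      + (p ^ e) * ∑[ j < P ] 𝟙 (p ^ e ∣? ∣ a * + (j ℕ.* j) ∣)
        ≡⟨ cong (_*_ (+ (p ^ e))) (∑-cong P λ j → cong (λ n → 𝟙 (p ^ e ∣? n)) (ℤ.abs-* a _)) ⟩
      + (p ^ e) * ∑[ j < P ] 𝟙 (p ^ e ∣? ∣ a ∣ ℕ.* (j ℕ.* j))
        ≡⟨ cong (_*_ (+ (p ^ e))) (count-p^e∣A*j*j p-prime p∤a k e ⌈e/2⌉≤k) ⟩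
      + (p ^ e) * + (p ^ (k ∸ ⌈ e /2⌉))
        ≡⟨ sym (pos-^-+ e (k ∸ ⌈ e /2⌉)) ⟩
      + (p ^ (e ℕ.+ (k ∸ ⌈ e /2⌉)))
        ≡⟨ cong (λ n → + (p ^ n)) exponent ⟩
      + (p ^ (k ℕ.+ ⌊ e /2⌋)) ∎
      where
      open ≡-Reasoning
      exponent : e ℕ.+ (k ∸ ⌈ e /2⌉) ≡ k ℕ.+ ⌊ e /2⌋
      exponent = trans (cong (ℕ._+ (k ∸ ⌈ e /2⌉)) (sym (ℕ.⌊n/2⌋+⌈n/2⌉≡n e)))
                (trans (ℕ.+-assoc ⌊ e /2⌋ ⌈ e /2⌉ _) (trans (cong (⌊ e /2⌋ ℕ.+_) (ℕ.m+[n∸m]≡n ⌈e/2⌉≤k)) (ℕ.+-comm ⌊ e /2⌋ k)))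

    P*P*p^[k+x] : ∀ x → + P * (+ P * + (p ^ (k ℕ.+ x))) ≡ + (p ^ (3 ℕ.* k ℕ.+ x))
    P*P*p^[k+x] x = begin
      + P * (+ P * + (p ^ (k ℕ.+ x)))        ≡⟨ cong (_*_ (+ P)) (sym (pos-^-+ k (k ℕ.+ x))) ⟩
      + P * + (p ^ (k ℕ.+ (k ℕ.+ x)))        ≡⟨ sym (pos-^-+ k (k ℕ.+ (k ℕ.+ x))) ⟩
      + (p ^ (k ℕ.+ (k ℕ.+ (k ℕ.+ x))))      ≡⟨ cong (λ n → + (p ^ n)) (lemma k x) ⟩
      + (p ^ (3 ℕ.* k ℕ.+ x))                ∎
      where
      open ≡-Reasoning
      lemma : ∀ k x → k ℕ.+ (k ℕ.+ (k ℕ.+ x)) ≡ 3 ℕ.* k ℕ.+ x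
      lemma = ℕ-Solver.solve-∀

    multiple-of-P : ∀ c n → k ≤ n → c * + (p ^ n) ≡ + P * (c * + (p ^ (n ∸ k)))
    multiple-of-P c n k≤n = trans (cong (λ m → c * + (p ^ m)) (sym (ℕ.m+[n∸m]≡n k≤n)))
      (trans (cong (_*_ c) (pos-^-+ k (n ∸ k))) (lemma c (+ P) _))
      where
      lemma : ∀ c P z → c * (P * z) ≡ P * (c * z)
      lemma = solve-∀

    ramanujan-∑-squares≡evenTerm : ∀ J′ → suc J′ ≤ k →
      + P * (+ P * ∑[ j < P ] (completeSumValue (suc J′) (a * + (j ℕ.* j)) - completeSumValue J′ (a * + (j ℕ.* j))))
      ≡ evenTerm p k (suc J′)
    ramanujan-∑-squares≡evenTerm J′ J≤k = begin
      + P * (+ P * ∑[ j < P ] (v (suc J′) j - v J′ j))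
        ≡⟨ cong (λ z → + P * (+ P * z)) (∑-distrib-- P (v (suc J′)) (v J′)) ⟩
      + P * (+ P * (∑ P (v (suc J′)) - ∑ P (v J′)))
        ≡⟨ cong₂ (λ x y → + P * (+ P * (x - y))) (∑-completeSumValue-squares (suc J′) (ℕ.≤-trans (ℕ.⌈n/2⌉≤n (suc J′)) J≤k))
                                                 (∑-completeSumValue-squares J′ (ℕ.≤-trans (ℕ.⌈n/2⌉≤n J′) (ℕ.≤-trans (ℕ.n≤1+n J′) J≤k))) ⟩
      + P * (+ P * (+ (p ^ (k ℕ.+ ⌊ suc J′ /2⌋)) - + (p ^ (k ℕ.+ ⌊ J′ /2⌋))))
        ≡⟨ lemma (+ P) _ _ ⟩
      + P * (+ P * + (p ^ (k ℕ.+ ⌊ suc J′ /2⌋))) - + P * (+ P * + (p ^ (k ℕ.+ ⌊ J′ /2⌋)))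
        ≡⟨ cong₂ _-_ (P*P*p^[k+x] ⌊ suc J′ /2⌋) (P*P*p^[k+x] ⌊ J′ /2⌋) ⟩
      + (p ^ (3 ℕ.* k ℕ.+ ⌊ suc J′ /2⌋)) - + (p ^ (3 ℕ.* k ℕ.+ ⌊ J′ /2⌋))
        ≡⟨ sym (evenTerm-telescopes p k J′) ⟩
      evenTerm p k (suc J′) ∎
      where
      open ≡-Reasoning
      v : ℕ → ℕ → ℤ
      v e j = completeSumValue e (a * + (j ℕ.* j))
      lemma : ∀ P x y → P * (P * (x - y)) ≡ P * (P * x) - P * (P * y)
      lemma = solve-∀

    s≈evenTerm : ∀ b₀ b₁ c₀ c₁ m₀ m₁ τ → τ < k → k ≤ m₁ ℕ.+ τ → k ≤ b₁ ℕ.+ τ → k ≤ c₁ ℕ.+ τ →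
                 s p a b₀ b₁ c₀ c₁ m₀ m₁ k τ ≈ const (evenTerm p k (k ∸ τ))
    s≈evenTerm b₀ b₁ c₀ c₁ m₀ m₁ τ τ<k k≤m₁+τ k≤b₁+τ k≤c₁+τ = begin
      s p a b₀ b₁ c₀ c₁ m₀ m₁ k τ
        ≡⟨ cong (λ n → Σ< (p ^ n) (λ t → if ⌊ p ∣? t ⌋ then [] else term t)) k∸τ≡J ⟩
      Σ< (p ^ suc J′) (λ t → if ⌊ p ∣? t ⌋ then [] else term t)
        ≈⟨ Σ<-cong (p ^ suc J′) (λ t → if-cong ⌊ p ∣? t ⌋ (collapse t)) ⟩
      Σ< (p ^ suc J′) (λ t → if ⌊ p ∣? t ⌋ then [] else P ⊙ P ⊙ G p k (X t))
        ≈⟨ ≈-trans (Σ<-if-⊙ (p ^ suc J′) P _ _) (⊙-cong P (Σ<-if-⊙ (p ^ suc J′) P _ _)) ⟩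
      P ⊙ P ⊙ Σ< (p ^ suc J′) (λ t → if ⌊ p ∣? t ⌋ then [] else G p k (X t))
        ≈⟨ ⊙-cong P (⊙-cong P (Σ<-units-G≈Σ<-ramanujanSum τ (suc J′) a)) ⟩
      P ⊙ P ⊙ Σ< P (λ j → ramanujanSum τ (suc J′) (a * + (j ℕ.* j)))
        ≈⟨ ⊙-cong P (⊙-cong P (≈-trans (Σ<-cong P λ j → ramanujanSum≈ τ J′ _ τ+J≡k) (const-Σ< P _))) ⟩
      P ⊙ P ⊙ const (∑[ j < P ] (completeSumValue (suc J′) (a * + (j ℕ.* j)) - completeSumValue J′ (a * + (j ℕ.* j))))
        ≈⟨ ≈-trans (⊙-cong P (⊙-const P _)) (⊙-const P _) ⟩
      const (+ P * (+ P * ∑[ j < P ] (completeSumValue (suc J′) (a * + (j ℕ.* j)) - completeSumValue J′ (a * + (j ℕ.* j)))))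
        ≡⟨ cong const (trans (ramanujan-∑-squares≡evenTerm J′ J≤k) (cong (evenTerm p k) (sym k∸τ≡J))) ⟩
      const (evenTerm p k (k ∸ τ)) ∎
      where
      open ≈-Reasoning
      τ≤k′ : τ ≤ k′
      τ≤k′ = ℕ.≤-pred τ<k
      J′ : ℕ
      J′ = k′ ∸ τ
      k∸τ≡J : k ∸ τ ≡ suc J′
      k∸τ≡J = ℕ.+-∸-assoc 1 τ≤k′
      τ+J≡k : τ ℕ.+ suc J′ ≡ k
      τ+J≡k = trans (ℕ.+-suc τ J′) (cong suc (ℕ.m+[n∸m]≡n τ≤k′))
      J≤k : suc J′ ≤ k
      J≤k = ℕ.s≤s (ℕ.m∸n≤m k′ τ)
      X : ℕ → ℤ
      X t = a * + t * + (p ^ τ)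
      term : ℕ → Cyc
      term t = eN (- (m₀ * + t * + (p ^ (m₁ ℕ.+ τ)))) ⊗ (G p k (X t) ⊗ (G p k (b₀ * + t * + (p ^ (b₁ ℕ.+ τ)))
                                                                 ⊗ G p k (c₀ * + t * + (p ^ (c₁ ℕ.+ τ)))))
      X₀≡ : ∀ t → - (m₀ * + t * + (p ^ (m₁ ℕ.+ τ))) ≡ + P * - (m₀ * + t * + (p ^ (m₁ ℕ.+ τ ∸ k)))
      X₀≡ t = trans (cong -_ (multiple-of-P (m₀ * + t) _ k≤m₁+τ)) (ℤ.neg-distribʳ-* (+ P) _)
      collapse : ∀ t → term t ≈ P ⊙ P ⊙ G p k (X t)
      collapse t = gauss-product-collapse (X t) _ _ _
        (X₀≡ t) (multiple-of-P (b₀ * + t) _ k≤b₁+τ) (multiple-of-P (c₀ * + t) _ k≤c₁+τ)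

    lhsSum≈midSum : ∀ b₀ b₁ c₀ c₁ → b₁ ≤ c₁ → ∀ m₀ m₁ →
                    lhsSum p a b₀ b₁ c₀ c₁ m₀ m₁ k ≈ const (midSum p (m₁ ℕ.⊓ b₁) k)
    lhsSum≈midSum b₀ b₁ c₀ c₁ b₁≤c₁ m₀ m₁ = begin
      lhsSum p a b₀ b₁ c₀ c₁ m₀ m₁ k                                     ≈⟨ Σ<-cong< k term≈ ⟩
      Σ< k (λ τ → const (if (k ∸ n₁) ≤ᵇ τ then evenTerm p k (k ∸ τ) else 0ℤ)) ≈⟨ const-Σ< k _ ⟩
      const (∑[ τ < k ] (if (k ∸ n₁) ≤ᵇ τ then evenTerm p k (k ∸ τ) else 0ℤ)) ≡⟨ cong const (midSum-as-∑ p n₁ k) ⟨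
      const (midSum p n₁ k)                                              ∎
      where
      open ≈-Reasoning
      n₁ : ℕ
      n₁ = m₁ ℕ.⊓ b₁
      term≈ : ∀ τ → τ < k → (if (k ∸ n₁) ≤ᵇ τ then s p a b₀ b₁ c₀ c₁ m₀ m₁ k τ else [])
                            ≈ const (if (k ∸ n₁) ≤ᵇ τ then evenTerm p k (k ∸ τ) else 0ℤ)
      term≈ τ τ<k with (k ∸ n₁) ≤ᵇ τ in eq
      ... | false = ≈-sym const-zero
      ... | true  = s≈evenTerm b₀ b₁ c₀ c₁ m₀ m₁ τ τ<k
                      (ℕ.≤-trans k≤n₁+τ (ℕ.+-monoˡ-≤ τ (ℕ.m⊓n≤m m₁ b₁)))
                      (ℕ.≤-trans k≤n₁+τ (ℕ.+-monoˡ-≤ τ (ℕ.m⊓n≤n m₁ b₁)))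
                      (ℕ.≤-trans k≤n₁+τ (ℕ.+-monoˡ-≤ τ (ℕ.≤-trans (ℕ.m⊓n≤n m₁ b₁) b₁≤c₁)))
        where
        k≤n₁+τ : k ≤ n₁ ℕ.+ τ
        k≤n₁+τ = ℕ.≤-trans (ℕ.m≤n+m∸n k n₁) (ℕ.+-monoʳ-≤ n₁ (ℕ.≤ᵇ⇒≤ (k ∸ n₁) τ (subst T (sym eq) tt)))

open import Data.Nat using (_*_)
open import Data.Nat.Divisibility as ℕD using ()
open import Data.Integer.Divisibility as ℤD using ()
open import Data.Integer.GCD using (gcd)

-- The hypothesis ¬ (+ p ℤD.∣ a) unfolds to ¬ p ∣ ∣ a ∣.
lemma4p3 : (p : ℕ) → Prime p → ¬ (2 ℕD.∣ p) →
  (a : ℤ) → ¬ ((+ p) ℤD.∣ a) →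
  (b₀ : ℤ) (b₁ : ℕ) (c₀ : ℤ) (c₁ : ℕ) → b₁ ≤ c₁ →
  gcd b₀ (+ p) ≡ 1ℤ → gcd c₀ (+ p) ≡ 1ℤ →
  (m₀ : ℤ) (m₁ : ℕ) → ¬ (m₀ ≡ 0ℤ) → gcd m₀ (+ p) ≡ 1ℤ →
  (k : ℕ) → m₁ < k →
  (lhsSum p a b₀ b₁ c₀ c₁ m₀ m₁ k ≈[ p ^ k ] const (midSum p (m₁ ℕ.⊓ b₁) k))
  × (midSum p (m₁ ℕ.⊓ b₁) k ≡ + (p ^ (3 * k)) ℤ.* (+ (p ^ ⌊ m₁ ℕ.⊓ b₁ /2⌋) ℤ.- 1ℤ))
lemma4p3 p p-prime _ a p∤a b₀ b₁ c₀ c₁ b₁≤c₁ _ _ m₀ m₁ _ _ (suc k′) m₁<k =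
    Cyclotomic.unwrap (Evaluation.lhsSum≈midSum p k′ p-prime {a} p∤a b₀ b₁ c₀ c₁ b₁≤c₁ m₀ m₁)
  , midSum-closed-form p (m₁ ℕ.⊓ b₁) (suc k′) (ℕ.≤-trans (ℕ.m⊓n≤m m₁ b₁) (ℕ.<⇒≤ m₁<k))
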